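{- Let $n,m\ge1$ and let $\boldsymbol\lambda,\boldsymbol\mu$ be $k$-tuples of partitions. Then $$\mathcal L^S_{\boldsymbol\lambda/\boldsymbol\mu}(x_1,\dots,x_{n-1},r;\,y_1,\dots,y_{m-1},-r;\,t)=\mathcal L^S_{\boldsymbol\lambda/\boldsymbol\mu}(x_1,\dots,x_{n-1};\,y_1,\dots,y_{m-1};\,t).$$
   Context: Fix an integer $k\ge1$ (colours $1,\dots,k$) and an indeterminate $t$. For $\mathbf I\in\{0,1\}^k$ let $|\mathbf I|=\sum_cI_c$, and for $\mathbf I,\mathbf J\in\mathbb Z^k$ let $\varphi(\mathbf I,\mathbf J)=\sum_{1\le c<d\le k}I_cJ_d$. A vertex is a unit square whose bottom, left, top, right edges carry labels $\mathbf I,\mathbf J,\mathbf K,\mathbf L\in\{0,1\}^k$; $I_c=1$ means a path of colour $c$ uses that edge (paths move up and right). White weight: $W_x(\mathbf I,\mathbf J,\mathbf K,\mathbf L)=\mathbf 1_{\mathbf I+\mathbf J=\mathbf K+\mathbf L}\prod_c\mathbf 1_{I_c+J_c\ne2}\,x^{|\mathbf L|}t^{\varphi(\mathbf L,\mathbf I+\mathbf J)}$; purple weight: $P_x(\mathbf I,\mathbf J,\mathbf K,\mathbf L)=\mathbf 1_{\mathbf I+\mathbf J=\mathbf K+\mathbf L}\prod_c\mathbf 1_{K_c\ge J_c}\,x^{|\mathbf L|}t^{\varphi(\mathbf L,\mathbf K-\mathbf J)}$. For $k$-tuples of partitions $\boldsymbol\lambda,\boldsymbol\mu$, each regarded as having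 exactly $\ell$ parts ($\ell$ large enough), and variables $X_n=(x_1,\dots,x_n)$, $Y_m=(y_1,\dots,y_m)$, consider the lattice with $n+m$ rows and columns $-\ell,\dots,N$ ($N$ large): rows $1,\dots,n$ from the bottom are white with parameters $x_1,\dots,x_n$, rows $n+1,\dots,n+m$ purple with parameters $y_1,\dots,y_m$; the bottom boundary edge of column $c$ carries colour $a$ iff $c=\mu^{(a)}_j-j$ for some $j$, the top boundary edge carries colour $a$ iff $c=\lambda^{(a)}_j-j$ for some $j$, left/right boundaries empty. $\mathcal L^S_{\boldsymbol\lambda/\boldsymbol\mu}(X_n;Y_m;t)$ is the sum over labellings of internal edges of the product of the vertex weights. -}

module Defs where

open import Data.Bool using (Bool; true; false; if_then_else_; _∧_; _∨_; not)
import Data.Bool.Properties as BoolP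
open import Data.Nat as ℕ using (ℕ; zero; suc; _∸_; _≡ᵇ_; _<ᵇ_)
open import Data.Fin using (Fin; toℕ)
import Data.Fin as Fin
open import Data.Vec as Vec using (Vec; []; _∷_; lookup)
import Data.Vec.Properties as VecP
open import Data.List as List using (List)
open import Data.Nat.ListAction using () renaming (sum to sumℕ)
open import Data.Bool.ListAction using () renaming (all to allB; any to anyB)
open import Relation.Nullary.Decidable using (⌊_⌋)
open import Algebra.Bundles using (CommutativeRing)

-- A label of an edge: which of the k colours use it ({0,1}^k).
Label : ℕ → Set
Label k = Vec Bool k

b2n : Bool → ℕ
b2n true = 1
b2n false = 0

size : ∀ {k} → Label k → ℕ
size I = Vec.sum (Vec.map b2n I)

φ : ∀ {k} → (Fin k → ℕ) → (Fin k → ℕ) → ℕ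
φ {k} L M = sumℕ (List.map (λ c → sumℕ (List.map
  (λ d → if toℕ c <ᵇ toℕ d then L c ℕ.* M d else 0) (List.allFin k))) (List.allFin k))

allVecs : ∀ {A : Set} → List A → (n : ℕ) → List (Vec A n)
allVecs as zero = [] List.∷ List.[]
allVecs as (suc n) = List.concatMap (λ a → List.map (a ∷_) (allVecs as n)) as

allLabels : (k : ℕ) → List (Label k)
allLabels k = allVecs (false List.∷ true List.∷ List.[]) k

emptyLabel : ∀ {k} → Label k
emptyLabel = Vec.replicate _ false

isEmpty : ∀ {k} → Label k → Bool
isEmpty I = Vec.foldr _ (λ b acc → not b ∧ acc) true I

allC : ∀ {k} → (Fin k → Bool) → Bool
allC {k} p = allB p (List.allFin k)

-- A partition with exactly ℓ parts (trailing zeros allowed): weakly decreasing.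
IsPartition : ∀ {ℓ} → Vec ℕ ℓ → Set
IsPartition v = ∀ i j → i Fin.≤ j → lookup v j ℕ.≤ lookup v i

-- Boundary labelling of the columns -ℓ,…,N (position p ↦ column p - ℓ):
-- colour a present iff p - ℓ = ν^(a)_j - j for some j ∈ {1,…,ℓ}
-- (with 0-based i = j - 1: ν_i + (ℓ - 1 - i) = p).
boundary : ∀ {k} (ℓ N : ℕ) → (Fin k → Vec ℕ ℓ) → Vec (Label k) (ℓ ℕ.+ N ℕ.+ 1)
boundary ℓ N ν = Vec.tabulate λ p → Vec.tabulate λ a →
  anyB (λ i → (lookup (ν a) i ℕ.+ (ℓ ∸ suc (toℕ i))) ≡ᵇ toℕ p) (List.allFin ℓ)

module _ {c ℓ'} (R : CommutativeRing c ℓ') where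
  open CommutativeRing R
  open import Algebra.Bundles using (Semiring)
  open import Algebra.Definitions.RawSemiring (Semiring.rawSemiring semiring) using (_^_)

  Σ[_]_ : ∀ {A : Set} → List A → (A → Carrier) → Carrier
  Σ[ as ] f = List.foldr (λ a acc → f a + acc) 0# as

  VertexWeight : ℕ → Set c
  VertexWeight k = Label k → Label k → Label k → Label k → Carrier

  conserve : ∀ {k} → Label k → Label k → Label k → Label k → Bool
  conserve I J K L = allC λ c →
    (b2n (lookup I c) ℕ.+ b2n (lookup J c)) ≡ᵇ (b2n (lookup K c) ℕ.+ b2n (lookup L c))

  white : ∀ {k} → Carrier → Carrier → VertexWeight k
  white t x I J K L =
    if conserve I J K L ∧ allC (λ c → not (lookup I c ∧ lookup J c))
    then x ^ size L * t ^ φ (λ c → b2n (lookup L c))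
                            (λ c → b2n (lookup I c) ℕ.+ b2n (lookup J c))
    else 0#

  purple : ∀ {k} → Carrier → Carrier → VertexWeight k
  purple t x I J K L =
    if conserve I J K L ∧ allC (λ c → not (lookup J c) ∨ lookup K c)
    then x ^ size L * t ^ φ (λ c → b2n (lookup L c))
                            (λ c → b2n (lookup K c) ∸ b2n (lookup J c))
    else 0#

  -- one row: J is the label of the left edge of the current vertex;
  -- sums over all labels of the horizontal edges; right boundary must be empty.
  rowW : ∀ {k W} → VertexWeight k → Label k → Vec (Label k) W → Vec (Label k) W → Carrier
  rowW w J [] [] = if isEmpty J then 1# else 0#
  rowW {k} w J (I ∷ Is) (K ∷ Ks) = Σ[ allLabels k ] λ L → w I J K L * rowW w L Is Ks

  -- rows listed bottom to top; sums over all labellings of the vertical edges between rows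
  Z : ∀ {k W} → List (VertexWeight k) → Vec (Label k) W → Vec (Label k) W → Carrier
  Z List.[] B T = if ⌊ VecP.≡-dec (VecP.≡-dec BoolP._≟_) B T ⌋ then 1# else 0#
  Z {k} {W} (w List.∷ ws) B T =
    Σ[ allVecs (allLabels k) W ] λ S → rowW w emptyLabel B S * Z ws S T

  LS : (k ℓ N : ℕ) → (t : Carrier) → (lam mu : Fin k → Vec ℕ ℓ) →
       ∀ {n m} → Vec Carrier n → Vec Carrier m → Carrier
  LS k ℓ N t lam mu xs ys =
    Z (List.map (white t) (Vec.toList xs) List.++ List.map (purple t) (Vec.toList ys))
      (boundary ℓ N mu) (boundary ℓ N lam)

module Submission where

open import Defs
open import Data.Bool using (Bool; true; false; if_then_else_; _∧_; _∨_; not)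
import Data.Bool.Properties as BoolP
open import Data.Nat as ℕ using (ℕ; zero; suc; _∸_; _≡ᵇ_; _≤_)
import Data.Nat.Properties as ℕP
import Data.Nat.Tactic.RingSolver as ℕ-Solver
open import Data.Nat.ListAction using () renaming (sum to sumℕ)
open import Data.Fin as F using (Fin; toℕ)
open import Data.Vec as Vec using (Vec; []; _∷_; lookup; _∷ʳ_)
import Data.Vec.Properties as VecP
open import Data.List as List using (List)
import Data.List.Properties as ListP
open import Data.Product using (_×_)
open import Function using (_∘_; id)
open import Relation.Nullary using (does)
open import Relation.Binary.PropositionalEquality as ≡ using (_≡_)
open import Algebra.Bundles using (CommutativeRing; CommutativeMonoid; RawSemiring; Semiring)
import Algebra.Properties.CommutativeSemigroup as CommSemigroupProperties

-- A white row with parameter r followed by a purple row with parameter −r acts as the identity on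
-- boundary data, and a white row commutes with every purple row above it; so the white row r moves
-- up past the purple rows y₁ … y_{m−1} and then cancels against the purple row −r.
--
-- Both facts about two adjacent rows follow from a train argument. Attach to the left end of the
-- white-over-purple strip a split vertex that sends each colour of a label C into the white row
-- (weight x) or into the purple row (weight y), and push it through the strip column by column: each
-- column contributes a scalar factor and changes C colour by colour. In the purple-over-white strip
-- the two left labels merge in the same way, and ∏_{j<|C|} (y + t^j x) intertwines the factors of the
-- two orders. For C empty this is the commutation; for y = −x the factors vanish unless top and
-- bottom boundary agree. The weights factor colour by colour, the twist t^φ becoming a power of t
-- counting earlier colours, so every local step is a finite identity in a single colour.

map-allFin-suc : ∀ {A : Set} k (g : Fin (suc k) → A) →
  List.map g (List.allFin (suc k)) ≡ g F.zero List.∷ List.map (g ∘ F.suc) (List.allFin k)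
map-allFin-suc k g =
  ≡.cong (g F.zero List.∷_) (≡.trans (ListP.map-tabulate F.suc g) (≡.sym (ListP.map-tabulate id (g ∘ F.suc))))

sumℕ-allFin-suc : ∀ k (g : Fin (suc k) → ℕ) →
  sumℕ (List.map g (List.allFin (suc k))) ≡ g F.zero ℕ.+ sumℕ (List.map (g ∘ F.suc) (List.allFin k))
sumℕ-allFin-suc k g = ≡.cong sumℕ (map-allFin-suc k g)

sumℕ-map-*ˡ : ∀ {A : Set} (n : ℕ) (g : A → ℕ) (ds : List A) →
  sumℕ (List.map (λ d → n ℕ.* g d) ds) ≡ n ℕ.* sumℕ (List.map g ds)
sumℕ-map-*ˡ n g List.[] = ≡.sym (ℕP.*-zeroʳ n)
sumℕ-map-*ˡ n g (d List.∷ ds) =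
  ≡.trans (≡.cong (n ℕ.* g d ℕ.+_) (sumℕ-map-*ˡ n g ds)) (≡.sym (ℕP.*-distribˡ-+ n (g d) _))

allC-suc : ∀ k (p : Fin (suc k) → Bool) → allC p ≡ p F.zero ∧ allC (p ∘ F.suc)
allC-suc k p = ≡.cong (List.foldr _∧_ true) (map-allFin-suc k p)

φ-suc : ∀ k (L M : Fin (suc k) → ℕ) →
  φ L M ≡ L F.zero ℕ.* sumℕ (List.map (M ∘ F.suc) (List.allFin k)) ℕ.+ φ (L ∘ F.suc) (M ∘ F.suc)
φ-suc k L M = ≡.trans (sumℕ-allFin-suc k (row L M)) (≡.cong₂ ℕ._+_ first-row other-rows)
  where
  row : (Fin (suc k) → ℕ) → (Fin (suc k) → ℕ) → Fin (suc k) → ℕ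
  row L M c = sumℕ (List.map (λ d → if toℕ c ℕ.<ᵇ toℕ d then L c ℕ.* M d else 0) (List.allFin (suc k)))
  first-row : row L M F.zero ≡ L F.zero ℕ.* sumℕ (List.map (M ∘ F.suc) (List.allFin k))
  first-row = ≡.trans (sumℕ-allFin-suc k (λ d → if 0 ℕ.<ᵇ toℕ d then L F.zero ℕ.* M d else 0))
                      (sumℕ-map-*ˡ (L F.zero) (M ∘ F.suc) (List.allFin k))
  other-rows : sumℕ (List.map (row L M ∘ F.suc) (List.allFin k)) ≡ φ (L ∘ F.suc) (M ∘ F.suc)
  other-rows = ≡.cong sumℕ (ListP.map-cong
    (λ c → sumℕ-allFin-suc k (λ d → if toℕ (F.suc c) ℕ.<ᵇ toℕ d then L (F.suc c) ℕ.* M d else 0)) (List.allFin k))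

exponent : (Bool → Bool → Bool → ℕ) → ∀ {n} → Label n → Label n → Label n → ℕ
exponent e [] [] [] = 0
exponent e (i ∷ I) (j ∷ J) (k ∷ K) = e i j k ℕ.+ exponent e I J K

sumℕ-allFin-exponent : ∀ (e : Bool → Bool → Bool → ℕ) {n} (I J K : Label n) →
  sumℕ (List.map (λ c → e (lookup I c) (lookup J c) (lookup K c)) (List.allFin n)) ≡ exponent e I J K
sumℕ-allFin-exponent e [] [] [] = ≡.refl
sumℕ-allFin-exponent e {suc n} (i ∷ I) (j ∷ J) (k ∷ K) =
  ≡.trans (sumℕ-allFin-suc n (λ c → e (lookup (i ∷ I) c) (lookup (j ∷ J) c) (lookup (k ∷ K) c)))
          (≡.cong (e i j k ℕ.+_) (sumℕ-allFin-exponent e I J K))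

ruleHolds : (Bool → Bool → Bool → Bool → Bool) → ∀ {n} → Label n → Label n → Label n → Label n → Bool
ruleHolds q I J K L = allC λ c → q (lookup I c) (lookup J c) (lookup K c) (lookup L c)

ruleHolds-∷ : ∀ q {n} i j k l (I J K L : Label n) →
  ruleHolds q (i ∷ I) (j ∷ J) (k ∷ K) (l ∷ L) ≡ q i j k l ∧ ruleHolds q I J K L
ruleHolds-∷ q {n} i j k l I J K L =
  allC-suc n (λ c → q (lookup (i ∷ I) c) (lookup (j ∷ J) c) (lookup (k ∷ K) c) (lookup (l ∷ L) c))

twist : (Bool → Bool → Bool → ℕ) → ∀ {n} → Label n → Label n → Label n → Label n → ℕ
twist e I J K L = φ (λ c → b2n (lookup L c)) (λ c → e (lookup I c) (lookup J c) (lookup K c))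

twist-∷ : ∀ e {n} i j k l (I J K L : Label n) →
  twist e (i ∷ I) (j ∷ J) (k ∷ K) (l ∷ L) ≡ b2n l ℕ.* exponent e I J K ℕ.+ twist e I J K L
twist-∷ e {n} i j k l I J K L =
  ≡.trans (φ-suc n (λ c → b2n (lookup (l ∷ L) c)) (λ c → e (lookup (i ∷ I) c) (lookup (j ∷ J) c) (lookup (k ∷ K) c)))
          (≡.cong (λ m → b2n l ℕ.* m ℕ.+ twist e I J K L) (sumℕ-allFin-exponent e I J K))

∧-interchange : ∀ a b c d → (a ∧ b) ∧ (c ∧ d) ≡ (a ∧ c) ∧ (b ∧ d)
∧-interchange = CommSemigroupProperties.interchange (CommutativeMonoid.commutativeSemigroup BoolP.∧-commutativeMonoid)

whiteRule purpleRule : Bool → Bool → Bool → Bool → Bool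
whiteRule i j k l = not (i ∧ j)
purpleRule i j k l = not j ∨ k

whiteExp purpleExp : Bool → Bool → Bool → ℕ
whiteExp i j k = b2n i ℕ.+ b2n j
purpleExp i j k = b2n k ∸ b2n j

carry : Bool → Bool → Bool → Bool
carry false i k = i ∧ not k
carry true i k = i ∨ not k

carryᵥ : ∀ {k} → Label k → Label k → Label k → Label k
carryᵥ [] [] [] = []
carryᵥ (c ∷ C) (i ∷ I) (k ∷ K) = carry c i k ∷ carryᵥ C I K

_∨ᵥ_ : ∀ {k} → Label k → Label k → Label k
[] ∨ᵥ [] = []
(p ∷ P) ∨ᵥ (q ∷ Q) = (p ∨ q) ∷ (P ∨ᵥ Q)

+-+-shuffle : ∀ a b p q → (a ℕ.+ p) ℕ.+ (b ℕ.+ q) ≡ (p ℕ.+ q) ℕ.+ (a ℕ.+ b)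
+-+-shuffle = ℕ-Solver.solve-∀

isEmpty⇒size≡0 : ∀ {k} (C : Label k) → isEmpty C ≡ true → size C ≡ 0
isEmpty⇒size≡0 [] _ = ≡.refl
isEmpty⇒size≡0 (false ∷ C) eq = isEmpty⇒size≡0 C eq

size-emptyLabel : ∀ k → size (emptyLabel {k}) ≡ 0
size-emptyLabel zero = ≡.refl
size-emptyLabel (suc k) = size-emptyLabel k

∨ᵥ-identityʳ : ∀ {k} (p : Label k) → p ∨ᵥ emptyLabel ≡ p
∨ᵥ-identityʳ [] = ≡.refl
∨ᵥ-identityʳ (b ∷ p) = ≡.cong₂ _∷_ (BoolP.∨-identityʳ b) (∨ᵥ-identityʳ p)

-- Over an arbitrary raw semiring, so that the ring solver can evaluate the syntactic instances.
module Local {ℓ₁ ℓ₂} (S : RawSemiring ℓ₁ ℓ₂) where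
  open RawSemiring S
  open import Algebra.Definitions.RawSemiring S using (_^_)

  Σ𝔹 : (Bool → Carrier) → Carrier
  Σ𝔹 f = f false + (f true + 0#)

  Σ𝔹³ : (Bool → Bool → Bool → Carrier) → Carrier
  Σ𝔹³ f = Σ𝔹 λ a → Σ𝔹 λ b → Σ𝔹 λ m → f a b m

  vertex₁ : (Bool → Bool → Bool → Bool → Bool) → (Bool → Bool → Bool → ℕ) →
            Carrier → Carrier → Bool → Bool → Bool → Bool → Carrier
  vertex₁ q e x T i j k l =
    if (b2n i ℕ.+ b2n j ≡ᵇ b2n k ℕ.+ b2n l) ∧ q i j k l then x ^ b2n l * T ^ e i j k else 0#

  white₁ purple₁ : Carrier → Carrier → Bool → Bool → Bool → Bool → Carrier
  white₁ = vertex₁ whiteRule whiteExp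
  purple₁ = vertex₁ purpleRule purpleExp

  -- A colour c entering a split vertex from the left leaves along the white row (a) or the purple
  -- row (b). Passing a column with bottom bit i and top bit k, it gains the factor coeffWP₁ (white
  -- row below) or coeffPW₁ (purple row below) and leaves the column as the bit carry c i k.
  split₁ split₁′ : Carrier → Carrier → Bool → Bool → Bool → Carrier → Carrier
  split₁ x y false false false T = 1#
  split₁ x y true  true  false T = x * T
  split₁ x y true  false true  T = y
  split₁ x y _     _     _     T = 0#

  split₁′ x y false false false T = 1#
  split₁′ x y true  true  false T = x * T
  split₁′ x y true  false true  T = y * T
  split₁′ x y _     _     _     T = 0#

  coeffWP₁ coeffPW₁ : Carrier → Carrier → Bool → Bool → Bool → Carrier → Carrier → Carrier
  coeffWP₁ x y false false false P T = 1#
  coeffWP₁ x y false true  false P T = 1#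
  coeffWP₁ x y false true  true  P T = P
  coeffWP₁ x y true  false false P T = x * T
  coeffWP₁ x y true  false true  P T = y + x * (T * P)
  coeffWP₁ x y true  true  true  P T = y
  coeffWP₁ x y _     _     _     P T = 0#

  coeffPW₁ x y false false false P T = 1#
  coeffPW₁ x y false true  false P T = y + x * (P * T)
  coeffPW₁ x y false true  true  P T = P
  coeffPW₁ x y true  false false P T = x * T
  coeffPW₁ x y true  false true  P T = 1#
  coeffPW₁ x y true  true  true  P T = y
  coeffPW₁ x y _     _     _     P T = 0#

  disjoint₁ : Bool → Bool → Carrier
  disjoint₁ true true = 0#
  disjoint₁ _    _    = 1#

module RowExchange {ℓ₁ ℓ₂} (R : CommutativeRing ℓ₁ ℓ₂) where
  open CommutativeRing R
  open import Algebra.Definitions.RawSemiring (Semiring.rawSemiring semiring) using (_^_)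
  open import Algebra.Properties.Semiring.Exp semiring using (^-homo-*; ^-assocʳ)
  open import Algebra.Properties.CommutativeSemigroup *-commutativeSemigroup
    using (x∙yz≈y∙xz) renaming (interchange to *-interchange)
  open import Relation.Binary.Reasoning.Setoid setoid
  open import Algebra.Solver.Ring.NaturalCoefficients.Default commutativeSemiring
  open Local (Semiring.rawSemiring semiring)

  ∑ : {A : Set} → List A → (A → Carrier) → Carrier
  ∑ = Σ[_]_ R

  -- ∑ bools f and Σ𝔹 f are definitionally equal.
  bools : List Bool
  bools = false List.∷ true List.∷ List.[]

  ∑-cong : ∀ {A : Set} (as : List A) {f g : A → Carrier} → (∀ a → f a ≈ g a) → ∑ as f ≈ ∑ as g
  ∑-cong List.[] f≈g = refl
  ∑-cong (a List.∷ as) f≈g = +-cong (f≈g a) (∑-cong as f≈g)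

  ∑-++ : ∀ {A : Set} (as bs : List A) (f : A → Carrier) → ∑ (as List.++ bs) f ≈ ∑ as f + ∑ bs f
  ∑-++ List.[] bs f = sym (+-identityˡ _)
  ∑-++ (a List.∷ as) bs f = trans (+-cong refl (∑-++ as bs f)) (sym (+-assoc _ _ _))

  ∑-map : ∀ {A B : Set} (h : A → B) (as : List A) (f : B → Carrier) → ∑ (List.map h as) f ≡ ∑ as (f ∘ h)
  ∑-map h List.[] f = ≡.refl
  ∑-map h (a List.∷ as) f = ≡.cong (f (h a) +_) (∑-map h as f)

  ∑-concatMap : ∀ {A B : Set} (h : A → List B) (as : List A) (f : B → Carrier) →
    ∑ (List.concatMap h as) f ≈ ∑ as (λ a → ∑ (h a) f)
  ∑-concatMap h List.[] f = refl
  ∑-concatMap h (a List.∷ as) f = trans (∑-++ (h a) _ f) (+-cong refl (∑-concatMap h as f))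

  ∑-+ : ∀ {A : Set} (as : List A) (f g : A → Carrier) → ∑ as (λ a → f a + g a) ≈ ∑ as f + ∑ as g
  ∑-+ List.[] f g = sym (+-identityˡ _)
  ∑-+ (a List.∷ as) f g = trans (+-cong refl (∑-+ as f g)) (+-assoc-interchange (f a) (g a) (∑ as f) (∑ as g))
    where
    +-assoc-interchange : ∀ u v w z → (u + v) + (w + z) ≈ (u + w) + (v + z)
    +-assoc-interchange = solve 4 (λ u v w z → (u :+ v) :+ (w :+ z) := (u :+ w) :+ (v :+ z)) refl

  *-∑ : ∀ {A : Set} (as : List A) (u : Carrier) (f : A → Carrier) → u * ∑ as f ≈ ∑ as (λ a → u * f a)
  *-∑ List.[] u f = zeroʳ u
  *-∑ (a List.∷ as) u f = trans (distribˡ u _ _) (+-cong refl (*-∑ as u f))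

  ∑-* : ∀ {A : Set} (as : List A) (u : Carrier) (f : A → Carrier) → ∑ as f * u ≈ ∑ as (λ a → f a * u)
  ∑-* List.[] u f = zeroˡ u
  ∑-* (a List.∷ as) u f = trans (distribʳ u _ _) (+-cong refl (∑-* as u f))

  ∑-0 : ∀ {A : Set} (as : List A) {f : A → Carrier} → (∀ a → f a ≈ 0#) → ∑ as f ≈ 0#
  ∑-0 List.[] f≈0 = refl
  ∑-0 (a List.∷ as) f≈0 = trans (+-cong (f≈0 a) (∑-0 as f≈0)) (+-identityˡ _)

  ∑-comm : ∀ {A B : Set} (as : List A) (bs : List B) (f : A → B → Carrier) →
    ∑ as (λ a → ∑ bs (f a)) ≈ ∑ bs (λ b → ∑ as (λ a → f a b))
  ∑-comm List.[] bs f = sym (∑-0 bs (λ _ → refl))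
  ∑-comm (a List.∷ as) bs f = trans (+-cong refl (∑-comm as bs f)) (sym (∑-+ bs (f a) _))

  ∑-bools : (f : Bool → Carrier) → ∑ bools f ≈ f false + f true
  ∑-bools f = +-cong refl (+-identityʳ _)

  ∑-allVecs-suc : ∀ {A : Set} (as : List A) (n : ℕ) (f : Vec A (suc n) → Carrier) →
    ∑ (allVecs as (suc n)) f ≈ ∑ as (λ a → ∑ (allVecs as n) (λ v → f (a ∷ v)))
  ∑-allVecs-suc as n f =
    trans (∑-concatMap _ as f) (∑-cong as (λ a → reflexive (∑-map (a ∷_) (allVecs as n) f)))

  ∑-allLabels-suc : ∀ k (f : Label (suc k) → Carrier) →
    ∑ (allLabels (suc k)) f ≈ Σ𝔹 (λ a → ∑ (allLabels k) (λ A → f (a ∷ A)))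
  ∑-allLabels-suc k = ∑-allVecs-suc bools k

  module _ (t : Carrier) where

    vertex : (Bool → Bool → Bool → Bool → Bool) → (Bool → Bool → Bool → ℕ) → Carrier → ∀ {k} → VertexWeight R k
    vertex q e x I J K L =
      if conserve R I J K L ∧ ruleHolds q I J K L then x ^ size L * t ^ twist e I J K L else 0#

    -- φ L M = Σ_d M_d · #{c < d ∣ L_c}: colour d is twisted by t to the number of earlier colours of L.
    vertexˣ : (Bool → Bool → Bool → Bool → Bool) → (Bool → Bool → Bool → ℕ) → Carrier → ℕ →
              ∀ {k} → Label k → Label k → Label k → Label k → Carrier
    vertexˣ q e x acc [] [] [] [] = 1#
    vertexˣ q e x acc (i ∷ I) (j ∷ J) (k ∷ K) (l ∷ L) =
      vertex₁ q e x (t ^ acc) i j k l * vertexˣ q e x (acc ℕ.+ b2n l) I J K L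

    module _ (q : Bool → Bool → Bool → Bool → Bool) (e : Bool → Bool → Bool → ℕ) (x : Carrier) where

      vertex-∷ : ∀ {n} i j k l (I J K L : Label n) →
        vertex q e x (i ∷ I) (j ∷ J) (k ∷ K) (l ∷ L) ≡
        (if ((b2n i ℕ.+ b2n j ≡ᵇ b2n k ℕ.+ b2n l) ∧ q i j k l) ∧ (conserve R I J K L ∧ ruleHolds q I J K L)
         then x ^ (b2n l ℕ.+ size L) * t ^ (b2n l ℕ.* exponent e I J K ℕ.+ twist e I J K L)
         else 0#)
      vertex-∷ {n} i j k l I J K L =
        ≡.cong₂ (λ b m → if b then x ^ (b2n l ℕ.+ size L) * t ^ m else 0#)
          (≡.trans (≡.cong₂ _∧_ conserve-∷ (ruleHolds-∷ q i j k l I J K L))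
                   (∧-interchange (b2n i ℕ.+ b2n j ≡ᵇ b2n k ℕ.+ b2n l) (conserve R I J K L) (q i j k l) (ruleHolds q I J K L)))
          (twist-∷ e i j k l I J K L)
        where
        conserve-∷ : conserve R (i ∷ I) (j ∷ J) (k ∷ K) (l ∷ L) ≡ (b2n i ℕ.+ b2n j ≡ᵇ b2n k ℕ.+ b2n l) ∧ conserve R I J K L
        conserve-∷ = allC-suc n (λ c → b2n (lookup (i ∷ I) c) ℕ.+ b2n (lookup (j ∷ J) c) ≡ᵇ
                                       b2n (lookup (k ∷ K) c) ℕ.+ b2n (lookup (l ∷ L) c))

      vertex-twisted-∷ : ∀ {n} acc i j k l (I J K L : Label n) →
        t ^ (acc ℕ.* exponent e (i ∷ I) (j ∷ J) (k ∷ K)) * vertex q e x (i ∷ I) (j ∷ J) (k ∷ K) (l ∷ L)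
        ≈ vertex₁ q e x (t ^ acc) i j k l * (t ^ ((acc ℕ.+ b2n l) ℕ.* exponent e I J K) * vertex q e x I J K L)
      vertex-twisted-∷ acc i j k l I J K L =
        trans (*-cong refl (reflexive (vertex-∷ i j k l I J K L))) (by-cases _ _)
        where
        E = exponent e I J K
        ph = twist e I J K L
        e₀ = e i j k
        l₀ = b2n l
        by-cases : ∀ b₁ b₂ →
          t ^ (acc ℕ.* (e₀ ℕ.+ E)) * (if b₁ ∧ b₂ then x ^ (l₀ ℕ.+ size L) * t ^ (l₀ ℕ.* E ℕ.+ ph) else 0#)
          ≈ (if b₁ then x ^ l₀ * (t ^ acc) ^ e₀ else 0#) * (t ^ ((acc ℕ.+ l₀) ℕ.* E) * (if b₂ then x ^ size L * t ^ ph else 0#))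
        by-cases false b₂ = trans (zeroʳ _) (sym (zeroˡ _))
        by-cases true false = trans (zeroʳ _) (sym (trans (*-cong refl (zeroʳ _)) (zeroʳ _)))
        by-cases true true = begin
          t ^ (acc ℕ.* (e₀ ℕ.+ E)) * (x ^ (l₀ ℕ.+ size L) * t ^ (l₀ ℕ.* E ℕ.+ ph))
            ≈⟨ *-cong (trans (reflexive (≡.cong (t ^_) (ℕP.*-distribˡ-+ acc e₀ E))) (^-homo-* t (acc ℕ.* e₀) (acc ℕ.* E)))
                      (*-cong (^-homo-* x l₀ (size L)) (^-homo-* t (l₀ ℕ.* E) ph)) ⟩
          (t ^ (acc ℕ.* e₀) * t ^ (acc ℕ.* E)) * ((x ^ l₀ * x ^ size L) * (t ^ (l₀ ℕ.* E) * t ^ ph))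
            ≈⟨ regroup _ _ _ _ _ _ ⟩
          (x ^ l₀ * t ^ (acc ℕ.* e₀)) * ((t ^ (acc ℕ.* E) * t ^ (l₀ ℕ.* E)) * (x ^ size L * t ^ ph))
            ≈⟨ *-cong (*-cong refl (sym (^-assocʳ t acc e₀)))
                      (*-cong (trans (sym (^-homo-* t (acc ℕ.* E) (l₀ ℕ.* E)))
                                     (reflexive (≡.cong (t ^_) (≡.sym (ℕP.*-distribʳ-+ E acc l₀))))) refl) ⟩
          (x ^ l₀ * (t ^ acc) ^ e₀) * (t ^ ((acc ℕ.+ l₀) ℕ.* E) * (x ^ size L * t ^ ph)) ∎
          where
          regroup : ∀ a b u v w z → (a * b) * ((u * v) * (w * z)) ≈ (u * a) * ((b * w) * (v * z))
          regroup = solve 6 (λ a b u v w z → (a :* b) :* ((u :* v) :* (w :* z)) := (u :* a) :* ((b :* w) :* (v :* z))) refl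

      vertex-twisted : ∀ {n} acc (I J K L : Label n) →
        t ^ (acc ℕ.* exponent e I J K) * vertex q e x I J K L ≈ vertexˣ q e x acc I J K L
      vertex-twisted acc [] [] [] [] =
        trans (*-cong (reflexive (≡.cong (t ^_) (ℕP.*-zeroʳ acc))) (*-identityˡ _)) (*-identityˡ _)
      vertex-twisted acc (i ∷ I) (j ∷ J) (k ∷ K) (l ∷ L) =
        trans (vertex-twisted-∷ acc i j k l I J K L) (*-cong refl (vertex-twisted (acc ℕ.+ b2n l) I J K L))

      vertex-factorises : ∀ {n} (I J K L : Label n) → vertex q e x I J K L ≈ vertexˣ q e x 0 I J K L
      vertex-factorises I J K L = trans (sym (*-identityˡ _)) (vertex-twisted 0 I J K L)

    white-factorises : ∀ x {k} (I J K L : Label k) → white R t x I J K L ≈ vertexˣ whiteRule whiteExp x 0 I J K L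
    white-factorises x = vertex-factorises whiteRule whiteExp x

    purple-factorises : ∀ y {k} (I J K L : Label k) → purple R t y I J K L ≈ vertexˣ purpleRule purpleExp y 0 I J K L
    purple-factorises y = vertex-factorises purpleRule purpleExp y

  -- One-colour identities

  polynomials : ℕ → RawSemiring _ _
  polynomials n = record
    { Carrier = Polynomial n ; _≈_ = _≡_ ; _+_ = _:+_ ; _*_ = _:*_ ; 0# = con 0 ; 1# = con 1 }

  module Syntax n = Local (polynomials n)

  column-splitˢ : Bool → Bool → Bool → Bool → Bool →
    Polynomial 5 → Polynomial 5 → Polynomial 5 → Polynomial 5 → Polynomial 5 → Polynomial 5 × Polynomial 5
  column-splitˢ c i k a' b' x y TA TB TR =
    S.Σ𝔹³ (λ a b m → S.split₁ x y c a b TR :* (S.white₁ x TA i a m a' :* S.purple₁ y TB m b k b'))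
    := S.coeffWP₁ x y c i k (TA :* TB) TR :* S.split₁′ x y (carry c i k) a' b' TA
    where module S = Syntax 5

  column-split : ∀ c i k a' b' (x y TA TB TR : Carrier) →
    Σ𝔹³ (λ a b m → split₁ x y c a b TR * (white₁ x TA i a m a' * purple₁ y TB m b k b'))
    ≈ coeffWP₁ x y c i k (TA * TB) TR * split₁′ x y (carry c i k) a' b' TA
  column-split c@false i@false k@false a@false b@false = solve 5 (column-splitˢ c i k a b) refl
  column-split c@false i@false k@false a@false b@true  = solve 5 (column-splitˢ c i k a b) refl
  column-split c@false i@false k@false a@true  b@false = solve 5 (column-splitˢ c i k a b) refl
  column-split c@false i@false k@false a@true  b@true  = solve 5 (column-splitˢ c i k a b) refl
  column-split c@false i@false k@true  a@false b@false = solve 5 (column-splitˢ c i k a b) refl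
  column-split c@false i@false k@true  a@false b@true  = solve 5 (column-splitˢ c i k a b) refl
  column-split c@false i@false k@true  a@true  b@false = solve 5 (column-splitˢ c i k a b) refl
  column-split c@false i@false k@true  a@true  b@true  = solve 5 (column-splitˢ c i k a b) refl
  column-split c@false i@true  k@false a@false b@false = solve 5 (column-splitˢ c i k a b) refl
  column-split c@false i@true  k@false a@false b@true  = solve 5 (column-splitˢ c i k a b) refl
  column-split c@false i@true  k@false a@true  b@false = solve 5 (column-splitˢ c i k a b) refl
  column-split c@false i@true  k@false a@true  b@true  = solve 5 (column-splitˢ c i k a b) refl
  column-split c@false i@true  k@true  a@false b@false = solve 5 (column-splitˢ c i k a b) refl
  column-split c@false i@true  k@true  a@false b@true  = solve 5 (column-splitˢ c i k a b) refl
  column-split c@false i@true  k@true  a@true  b@false = solve 5 (column-splitˢ c i k a b) refl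
  column-split c@false i@true  k@true  a@true  b@true  = solve 5 (column-splitˢ c i k a b) refl
  column-split c@true  i@false k@false a@false b@false = solve 5 (column-splitˢ c i k a b) refl
  column-split c@true  i@false k@false a@false b@true  = solve 5 (column-splitˢ c i k a b) refl
  column-split c@true  i@false k@false a@true  b@false = solve 5 (column-splitˢ c i k a b) refl
  column-split c@true  i@false k@false a@true  b@true  = solve 5 (column-splitˢ c i k a b) refl
  column-split c@true  i@false k@true  a@false b@false = solve 5 (column-splitˢ c i k a b) refl
  column-split c@true  i@false k@true  a@false b@true  = solve 5 (column-splitˢ c i k a b) refl
  column-split c@true  i@false k@true  a@true  b@false = solve 5 (column-splitˢ c i k a b) refl
  column-split c@true  i@false k@true  a@true  b@true  = solve 5 (column-splitˢ c i k a b) refl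
  column-split c@true  i@true  k@false a@false b@false = solve 5 (column-splitˢ c i k a b) refl
  column-split c@true  i@true  k@false a@false b@true  = solve 5 (column-splitˢ c i k a b) refl
  column-split c@true  i@true  k@false a@true  b@false = solve 5 (column-splitˢ c i k a b) refl
  column-split c@true  i@true  k@false a@true  b@true  = solve 5 (column-splitˢ c i k a b) refl
  column-split c@true  i@true  k@true  a@false b@false = solve 5 (column-splitˢ c i k a b) refl
  column-split c@true  i@true  k@true  a@false b@true  = solve 5 (column-splitˢ c i k a b) refl
  column-split c@true  i@true  k@true  a@true  b@false = solve 5 (column-splitˢ c i k a b) refl
  column-split c@true  i@true  k@true  a@true  b@true  = solve 5 (column-splitˢ c i k a b) refl

  column-mergeˢ : Bool → Bool → Bool → Bool →
    Polynomial 7 → Polynomial 7 → Polynomial 7 → Polynomial 7 → Polynomial 7 → Polynomial 7 → Polynomial 7 →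
    Polynomial 7 × Polynomial 7
  column-mergeˢ p q i k x y TP TQ TR G₀ G₁ =
    S.Σ𝔹³ (λ m p' q' → (S.purple₁ y TP i p m p' :* S.white₁ x TQ m q k q')
                        :* (S.disjoint₁ p' q' :* ((TR S.^ b2n q') :* G (p' ∨ q'))))
    := S.disjoint₁ p q :* ((TQ S.^ b2n (p ∨ q)) :* (S.coeffPW₁ x y (p ∨ q) i k (TP :* TQ) TR :* G (carry (p ∨ q) i k)))
    where
    module S where
      open Syntax 7 public
      open import Algebra.Definitions.RawSemiring (polynomials 7) using (_^_) public
    G : Bool → Polynomial 7
    G b = if b then G₁ else G₀

  column-merge : ∀ p q i k (x y TP TQ TR : Carrier) (G : Bool → Carrier) →
    Σ𝔹³ (λ m p' q' → (purple₁ y TP i p m p' * white₁ x TQ m q k q') * (disjoint₁ p' q' * (TR ^ b2n q' * G (p' ∨ q'))))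
    ≈ disjoint₁ p q * (TQ ^ b2n (p ∨ q) * (coeffPW₁ x y (p ∨ q) i k (TP * TQ) TR * G (carry (p ∨ q) i k)))
  column-merge p@false q@false i@false k@false x y TP TQ TR G =
    solve 7 (column-mergeˢ p q i k) refl x y TP TQ TR (G false) (G true)
  column-merge p@false q@false i@false k@true  x y TP TQ TR G =
    solve 7 (column-mergeˢ p q i k) refl x y TP TQ TR (G false) (G true)
  column-merge p@false q@false i@true  k@false x y TP TQ TR G =
    solve 7 (column-mergeˢ p q i k) refl x y TP TQ TR (G false) (G true)
  column-merge p@false q@false i@true  k@true  x y TP TQ TR G =
    solve 7 (column-mergeˢ p q i k) refl x y TP TQ TR (G false) (G true)
  column-merge p@false q@true  i@false k@false x y TP TQ TR G =
    solve 7 (column-mergeˢ p q i k) refl x y TP TQ TR (G false) (G true)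
  column-merge p@false q@true  i@false k@true  x y TP TQ TR G =
    solve 7 (column-mergeˢ p q i k) refl x y TP TQ TR (G false) (G true)
  column-merge p@false q@true  i@true  k@false x y TP TQ TR G =
    solve 7 (column-mergeˢ p q i k) refl x y TP TQ TR (G false) (G true)
  column-merge p@false q@true  i@true  k@true  x y TP TQ TR G =
    solve 7 (column-mergeˢ p q i k) refl x y TP TQ TR (G false) (G true)
  column-merge p@true  q@false i@false k@false x y TP TQ TR G =
    solve 7 (column-mergeˢ p q i k) refl x y TP TQ TR (G false) (G true)
  column-merge p@true  q@false i@false k@true  x y TP TQ TR G =
    solve 7 (column-mergeˢ p q i k) refl x y TP TQ TR (G false) (G true)
  column-merge p@true  q@false i@true  k@false x y TP TQ TR G =
    solve 7 (column-mergeˢ p q i k) refl x y TP TQ TR (G false) (G true)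
  column-merge p@true  q@false i@true  k@true  x y TP TQ TR G =
    solve 7 (column-mergeˢ p q i k) refl x y TP TQ TR (G false) (G true)
  column-merge p@true  q@true  i@false k@false x y TP TQ TR G =
    solve 7 (column-mergeˢ p q i k) refl x y TP TQ TR (G false) (G true)
  column-merge p@true  q@true  i@false k@true  x y TP TQ TR G =
    solve 7 (column-mergeˢ p q i k) refl x y TP TQ TR (G false) (G true)
  column-merge p@true  q@true  i@true  k@false x y TP TQ TR G =
    solve 7 (column-mergeˢ p q i k) refl x y TP TQ TR (G false) (G true)
  column-merge p@true  q@true  i@true  k@true  x y TP TQ TR G =
    solve 7 (column-mergeˢ p q i k) refl x y TP TQ TR (G false) (G true)
  split₁′-support : ∀ x y c a b T (g : ℕ → Carrier) →
    split₁′ x y c a b T * g (b2n a ℕ.+ b2n b) ≈ split₁′ x y c a b T * g (b2n c)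
  split₁′-support x y false false false T g = refl
  split₁′-support x y true  true  false T g = refl
  split₁′-support x y true  false true  T g = refl
  split₁′-support x y false false true  T g = trans (zeroˡ _) (sym (zeroˡ _))
  split₁′-support x y false true  false T g = trans (zeroˡ _) (sym (zeroˡ _))
  split₁′-support x y false true  true  T g = trans (zeroˡ _) (sym (zeroˡ _))
  split₁′-support x y true  false false T g = trans (zeroˡ _) (sym (zeroˡ _))
  split₁′-support x y true  true  true  T g = trans (zeroˡ _) (sym (zeroˡ _))

  disjoint₁-support : ∀ p q (g : ℕ → Carrier) → disjoint₁ p q * g (b2n p ℕ.+ b2n q) ≈ disjoint₁ p q * g (b2n (p ∨ q))
  disjoint₁-support false false g = refl
  disjoint₁-support false true  g = refl
  disjoint₁-support true  false g = refl
  disjoint₁-support true  true  g = trans (zeroˡ _) (sym (zeroˡ _))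

  coeffWP₁-cong : ∀ x y c i k {P P'} T → P ≈ P' → coeffWP₁ x y c i k P T ≈ coeffWP₁ x y c i k P' T
  coeffWP₁-cong x y false false false T P≈P' = refl
  coeffWP₁-cong x y false false true  T P≈P' = refl
  coeffWP₁-cong x y false true  false T P≈P' = refl
  coeffWP₁-cong x y false true  true  T P≈P' = P≈P'
  coeffWP₁-cong x y true  false false T P≈P' = refl
  coeffWP₁-cong x y true  false true  T P≈P' = +-cong refl (*-cong refl (*-cong refl P≈P'))
  coeffWP₁-cong x y true  true  false T P≈P' = refl
  coeffWP₁-cong x y true  true  true  T P≈P' = refl

  coeffPW₁-cong : ∀ x y c i k {P P'} T → P ≈ P' → coeffPW₁ x y c i k P T ≈ coeffPW₁ x y c i k P' T
  coeffPW₁-cong x y false false false T P≈P' = refl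
  coeffPW₁-cong x y false false true  T P≈P' = refl
  coeffPW₁-cong x y false true  false T P≈P' = +-cong refl (*-cong refl (*-cong P≈P' refl))
  coeffPW₁-cong x y false true  true  T P≈P' = P≈P'
  coeffPW₁-cong x y true  false false T P≈P' = refl
  coeffPW₁-cong x y true  false true  T P≈P' = refl
  coeffPW₁-cong x y true  true  false T P≈P' = refl
  coeffPW₁-cong x y true  true  true  T P≈P' = refl

  disjoint : ∀ {k} → Label k → Label k → Carrier
  disjoint [] [] = 1#
  disjoint (p ∷ P) (q ∷ Q) = disjoint₁ p q * disjoint P Q

  ∑³ : ∀ {k} → (Label k → Label k → Label k → Carrier) → Carrier
  ∑³ {k} G = ∑ (allLabels k) λ A → ∑ (allLabels k) λ B → ∑ (allLabels k) λ M → G A B M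

  ∑³-cong : ∀ {k} {G H : Label k → Label k → Label k → Carrier} → (∀ A B M → G A B M ≈ H A B M) → ∑³ G ≈ ∑³ H
  ∑³-cong {k} G≈H = ∑-cong L λ A → ∑-cong L λ B → ∑-cong L λ M → G≈H A B M
    where L = allLabels k

  Σ𝔹³-cong : ∀ {g h : Bool → Bool → Bool → Carrier} → (∀ a b m → g a b m ≈ h a b m) → Σ𝔹³ g ≈ Σ𝔹³ h
  Σ𝔹³-cong g≈h = ∑-cong bools λ a → ∑-cong bools λ b → ∑-cong bools λ m → g≈h a b m

  ∑³-zero : (G : Label 0 → Label 0 → Label 0 → Carrier) → ∑³ G ≈ G [] [] []
  ∑³-zero G = trans (+-identityʳ _) (trans (+-identityʳ _) (+-identityʳ _))

  ∑³-suc : ∀ {k} (G : Label (suc k) → Label (suc k) → Label (suc k) → Carrier) →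
    ∑³ G ≈ Σ𝔹³ (λ a b m → ∑³ (λ A B M → G (a ∷ A) (b ∷ B) (m ∷ M)))
  ∑³-suc {k} G = begin
    ∑³ G
      ≈⟨ trans (∑-allLabels-suc k λ A → ∑ L′ λ B → ∑ L′ λ M → G A B M) (∑-cong bools λ a → ∑-cong L λ A →
           trans (∑-allLabels-suc k λ B → ∑ L′ λ M → G (a ∷ A) B M) (∑-cong bools λ b → ∑-cong L λ B →
             ∑-allLabels-suc k (G (a ∷ A) (b ∷ B)))) ⟩
    (Σ𝔹 λ a → ∑ L λ A → Σ𝔹 λ b → ∑ L λ B → Σ𝔹 λ m → ∑ L λ M → G (a ∷ A) (b ∷ B) (m ∷ M))
      ≈⟨ ∑-cong bools (λ a → ∑-cong L λ A → ∑-cong bools λ b →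
           ∑-comm L bools (λ B m → ∑ L λ M → G (a ∷ A) (b ∷ B) (m ∷ M))) ⟩
    (Σ𝔹 λ a → ∑ L λ A → Σ𝔹 λ b → Σ𝔹 λ m → ∑ L λ B → ∑ L λ M → G (a ∷ A) (b ∷ B) (m ∷ M))
      ≈⟨ ∑-cong bools (λ a → ∑-comm L bools (λ A b → Σ𝔹 λ m → ∑ L λ B → ∑ L λ M → G (a ∷ A) (b ∷ B) (m ∷ M))) ⟩
    (Σ𝔹 λ a → Σ𝔹 λ b → ∑ L λ A → Σ𝔹 λ m → ∑ L λ B → ∑ L λ M → G (a ∷ A) (b ∷ B) (m ∷ M))
      ≈⟨ ∑-cong bools (λ a → ∑-cong bools λ b → ∑-comm L bools (λ A m → ∑ L λ B → ∑ L λ M → G (a ∷ A) (b ∷ B) (m ∷ M))) ⟩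
    Σ𝔹³ (λ a b m → ∑³ (λ A B M → G (a ∷ A) (b ∷ B) (m ∷ M))) ∎
    where
    L = allLabels k
    L′ = allLabels (suc k)

  ∑³-*ˡ : ∀ {k} u (G : Label k → Label k → Label k → Carrier) → ∑³ (λ A B M → u * G A B M) ≈ u * ∑³ G
  ∑³-*ˡ {k} u G = sym (trans (*-∑ L u _) (∑-cong L λ A → trans (*-∑ L u _) (∑-cong L λ B → *-∑ L u _)))
    where L = allLabels k

  Σ𝔹³-*ʳ : ∀ (g : Bool → Bool → Bool → Carrier) u → Σ𝔹³ (λ a b m → g a b m * u) ≈ Σ𝔹³ g * u
  Σ𝔹³-*ʳ g u = sym (trans (∑-* bools u (λ a → Σ𝔹 λ b → Σ𝔹 λ m → g a b m)) (∑-cong bools λ a →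
                        trans (∑-* bools u (λ b → Σ𝔹 λ m → g a b m)) (∑-cong bools λ b → ∑-* bools u (g a b))))

  ^-*-distribʳ-+ : ∀ t a q n → t ^ ((a ℕ.+ q) ℕ.* n) ≈ t ^ (a ℕ.* n) * (t ^ n) ^ q
  ^-*-distribʳ-+ t a q n = begin
    t ^ ((a ℕ.+ q) ℕ.* n)        ≡⟨ ≡.cong (t ^_) (≡.trans (ℕP.*-distribʳ-+ n a q) (≡.cong (a ℕ.* n ℕ.+_) (ℕP.*-comm q n))) ⟩
    t ^ (a ℕ.* n ℕ.+ n ℕ.* q)    ≈⟨ ^-homo-* t (a ℕ.* n) (n ℕ.* q) ⟩
    t ^ (a ℕ.* n) * t ^ (n ℕ.* q) ≈⟨ *-cong refl (sym (^-assocʳ t n q)) ⟩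
    t ^ (a ℕ.* n) * (t ^ n) ^ q  ∎

  ^-*-distribˡ-+ : ∀ t a c n → t ^ (a ℕ.* (c ℕ.+ n)) ≈ (t ^ a) ^ c * t ^ (a ℕ.* n)
  ^-*-distribˡ-+ t a c n = begin
    t ^ (a ℕ.* (c ℕ.+ n))          ≡⟨ ≡.cong (t ^_) (ℕP.*-distribˡ-+ a c n) ⟩
    t ^ (a ℕ.* c ℕ.+ a ℕ.* n)      ≈⟨ ^-homo-* t (a ℕ.* c) (a ℕ.* n) ⟩
    t ^ (a ℕ.* c) * t ^ (a ℕ.* n)  ≈⟨ *-cong (sym (^-assocʳ t a c)) refl ⟩
    (t ^ a) ^ c * t ^ (a ℕ.* n)    ∎

  χ≡ : ∀ {k} → Label k → Label k → Carrier
  χ≡ I K = if does (VecP.≡-dec BoolP._≟_ I K) then 1# else 0#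

  χ≡ᵥ : ∀ {k W} → Vec (Label k) W → Vec (Label k) W → Carrier
  χ≡ᵥ [] [] = 1#
  χ≡ᵥ (I ∷ Is) (K ∷ Ks) = χ≡ I K * χ≡ᵥ Is Ks

  χ∅ : ∀ {k} → Label k → Carrier
  χ∅ C = if isEmpty C then 1# else 0#

  χ∅≈χ≡∅ : ∀ {k} (C : Label k) → χ∅ C ≈ χ≡ emptyLabel C
  χ∅≈χ≡∅ [] = refl
  χ∅≈χ≡∅ (false ∷ C) = χ∅≈χ≡∅ C
  χ∅≈χ≡∅ (true ∷ C) = refl

  ∑-χ≡ : ∀ {k} (I : Label k) (g : Label k → Carrier) → ∑ (allLabels k) (λ K → χ≡ I K * g K) ≈ g I
  ∑-χ≡ [] g = trans (+-identityʳ _) (*-identityˡ _)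
  ∑-χ≡ {suc k} (false ∷ I) g = begin
    ∑ (allLabels (suc k)) (λ K → χ≡ (false ∷ I) K * g K)
      ≈⟨ trans (∑-allLabels-suc k (λ K → χ≡ (false ∷ I) K * g K)) (∑-bools λ b → ∑ (allLabels k) λ K → χ≡ (false ∷ I) (b ∷ K) * g (b ∷ K)) ⟩
    ∑ (allLabels k) (λ K → χ≡ I K * g (false ∷ K)) + ∑ (allLabels k) (λ K → 0# * g (true ∷ K))
      ≈⟨ +-cong (∑-χ≡ I (λ K → g (false ∷ K))) (∑-0 (allLabels k) (λ K → zeroˡ _)) ⟩
    g (false ∷ I) + 0#
      ≈⟨ +-identityʳ _ ⟩
    g (false ∷ I) ∎
  ∑-χ≡ {suc k} (true ∷ I) g = begin
    ∑ (allLabels (suc k)) (λ K → χ≡ (true ∷ I) K * g K)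
      ≈⟨ trans (∑-allLabels-suc k (λ K → χ≡ (true ∷ I) K * g K)) (∑-bools λ b → ∑ (allLabels k) λ K → χ≡ (true ∷ I) (b ∷ K) * g (b ∷ K)) ⟩
    ∑ (allLabels k) (λ K → 0# * g (false ∷ K)) + ∑ (allLabels k) (λ K → χ≡ I K * g (true ∷ K))
      ≈⟨ +-cong (∑-0 (allLabels k) (λ K → zeroˡ _)) (∑-χ≡ I (λ K → g (true ∷ K))) ⟩
    0# + g (true ∷ I)
      ≈⟨ +-identityˡ _ ⟩
    g (true ∷ I) ∎

  ∑-χ∅ : ∀ {k} (g : Label k → Carrier) → ∑ (allLabels k) (λ C → χ∅ C * g C) ≈ g emptyLabel
  ∑-χ∅ {k} g = trans (∑-cong (allLabels k) (λ C → *-cong (χ∅≈χ≡∅ C) refl)) (∑-χ≡ emptyLabel g)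

  ∑-χ≡ᵥ : ∀ {k W} (Is : Vec (Label k) W) (g : Vec (Label k) W → Carrier) →
    ∑ (allVecs (allLabels k) W) (λ Ks → χ≡ᵥ Is Ks * g Ks) ≈ g Is
  ∑-χ≡ᵥ [] g = trans (+-identityʳ _) (*-identityˡ _)
  ∑-χ≡ᵥ {k} {suc W} (I ∷ Is) g = begin
    ∑ (allVecs L (suc W)) (λ Ks → χ≡ᵥ (I ∷ Is) Ks * g Ks)
      ≈⟨ ∑-allVecs-suc L W (λ Ks → χ≡ᵥ (I ∷ Is) Ks * g Ks) ⟩
    ∑ L (λ K → ∑ (allVecs L W) (λ Ks → (χ≡ I K * χ≡ᵥ Is Ks) * g (K ∷ Ks)))
      ≈⟨ ∑-cong L (λ K → trans (∑-cong (allVecs L W) (λ Ks → *-assoc _ _ _)) (sym (*-∑ (allVecs L W) _ _))) ⟩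
    ∑ L (λ K → χ≡ I K * ∑ (allVecs L W) (λ Ks → χ≡ᵥ Is Ks * g (K ∷ Ks)))
      ≈⟨ ∑-cong L (λ K → *-cong refl (∑-χ≡ᵥ Is (λ Ks → g (K ∷ Ks)))) ⟩
    ∑ L (λ K → χ≡ I K * g (K ∷ Is))
      ≈⟨ ∑-χ≡ I (λ K → g (K ∷ Is)) ⟩
    g (I ∷ Is) ∎
    where L = allLabels k

  χ∅-∨ᵥ : ∀ {k} (p q : Label k) → χ∅ p * χ∅ q ≈ disjoint p q * χ∅ (p ∨ᵥ q)
  χ∅-∨ᵥ [] [] = refl
  χ∅-∨ᵥ (false ∷ p) (false ∷ q) = trans (χ∅-∨ᵥ p q) (*-cong (sym (*-identityˡ _)) refl)
  χ∅-∨ᵥ (false ∷ p) (true ∷ q) = trans (zeroʳ _) (sym (zeroʳ _))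
  χ∅-∨ᵥ (true ∷ p) (false ∷ q) = trans (zeroˡ _) (sym (zeroʳ _))
  χ∅-∨ᵥ (true ∷ p) (true ∷ q) = trans (zeroˡ _) (sym (trans (*-cong (zeroˡ _) refl) (zeroˡ _)))

  disjoint-emptyˡ : ∀ {k} (p : Label k) → disjoint p emptyLabel ≈ 1#
  disjoint-emptyˡ [] = refl
  disjoint-emptyˡ (false ∷ p) = trans (*-identityˡ _) (disjoint-emptyˡ p)
  disjoint-emptyˡ (true ∷ p) = trans (*-identityˡ _) (disjoint-emptyˡ p)

  χ∅-emptyLabel : ∀ k → χ∅ (emptyLabel {k}) ≈ 1#
  χ∅-emptyLabel zero = refl
  χ∅-emptyLabel (suc k) = χ∅-emptyLabel k

  -- Strips of two rows

  strip : ∀ {k W} → VertexWeight R k → VertexWeight R k → Label k → Label k → Vec (Label k) W → Vec (Label k) W → Carrier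
  strip w₁ w₂ a b [] [] = χ∅ a * χ∅ b
  strip {k} w₁ w₂ a b (I ∷ Is) (K ∷ Ks) =
    ∑ L λ M → ∑ L λ a' → ∑ L λ b' → (w₁ I a M a' * w₂ M b K b') * strip w₁ w₂ a' b' Is Ks
    where L = allLabels k

  ∑-rowW-rowW : ∀ {k W} (w₁ w₂ : VertexWeight R k) (a b : Label k) (Bs Ts : Vec (Label k) W) →
    ∑ (allVecs (allLabels k) W) (λ Ss → rowW R w₁ a Bs Ss * rowW R w₂ b Ss Ts) ≈ strip w₁ w₂ a b Bs Ts
  ∑-rowW-rowW w₁ w₂ a b [] [] = +-identityʳ _
  ∑-rowW-rowW {k} {suc W} w₁ w₂ a b (I ∷ Is) (K ∷ Ks) = begin
    ∑ (allVecs L (suc W)) (λ Ss → rowW R w₁ a (I ∷ Is) Ss * rowW R w₂ b Ss (K ∷ Ks))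
      ≈⟨ ∑-allVecs-suc L W _ ⟩
    ∑ L (λ M → ∑ Vs (λ Ss → ∑ L (λ a' → w₁ I a M a' * rowW R w₁ a' Is Ss) * ∑ L (λ b' → w₂ M b K b' * rowW R w₂ b' Ss Ks)))
      ≈⟨ ∑-cong L (λ M → ∑-cong Vs λ Ss → trans (∑-* L _ _) (∑-cong L λ a' →
           trans (*-∑ L _ _) (∑-cong L λ b' → *-interchange _ _ _ _))) ⟩
    ∑ L (λ M → ∑ Vs (λ Ss → ∑ L (λ a' → ∑ L (λ b' → (w₁ I a M a' * w₂ M b K b') * (rowW R w₁ a' Is Ss * rowW R w₂ b' Ss Ks)))))
      ≈⟨ ∑-cong L (λ M → trans (∑-comm Vs L _) (∑-cong L λ a' → ∑-comm Vs L _)) ⟩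
    ∑ L (λ M → ∑ L (λ a' → ∑ L (λ b' → ∑ Vs (λ Ss → (w₁ I a M a' * w₂ M b K b') * (rowW R w₁ a' Is Ss * rowW R w₂ b' Ss Ks)))))
      ≈⟨ ∑-cong L (λ M → ∑-cong L λ a' → ∑-cong L λ b' → trans (sym (*-∑ Vs _ _)) (*-cong refl (∑-rowW-rowW w₁ w₂ a' b' Is Ks))) ⟩
    strip w₁ w₂ a b (I ∷ Is) (K ∷ Ks) ∎
    where
    L = allLabels k
    Vs = allVecs L W

  ∑-strip-∷ : ∀ {k W} (α : Label k → Label k → Carrier) (w₁ w₂ : VertexWeight R k) (I K : Label k) (Is Ks : Vec (Label k) W) →
    ∑ (allLabels k) (λ A → ∑ (allLabels k) (λ B → α A B * strip w₁ w₂ A B (I ∷ Is) (K ∷ Ks)))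
    ≈ ∑ (allLabels k) (λ A' → ∑ (allLabels k) (λ B' →
        ∑³ (λ A B M → α A B * (w₁ I A M A' * w₂ M B K B')) * strip w₁ w₂ A' B' Is Ks))
  ∑-strip-∷ {k} α w₁ w₂ I K Is Ks = begin
    ∑ L (λ A → ∑ L (λ B → α A B * ∑ L (λ M → ∑ L (λ A' → ∑ L (λ B' → w A B M A' B' * D A' B')))))
      ≈⟨ ∑-cong L (λ A → ∑-cong L λ B → trans (*-∑ L _ _) (∑-cong L λ M → trans (*-∑ L _ _) (∑-cong L λ A' →
           trans (*-∑ L _ _) (∑-cong L λ B' → sym (*-assoc _ _ _))))) ⟩
    ∑ L (λ A → ∑ L (λ B → ∑ L (λ M → ∑ L (λ A' → ∑ L (λ B' → v A B M A' B')))))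
      ≈⟨ ∑-cong L (λ A → ∑-cong L λ B → ∑-comm L L _) ⟩
    ∑ L (λ A → ∑ L (λ B → ∑ L (λ A' → ∑ L (λ M → ∑ L (λ B' → v A B M A' B')))))
      ≈⟨ ∑-cong L (λ A → ∑-comm L L _) ⟩
    ∑ L (λ A → ∑ L (λ A' → ∑ L (λ B → ∑ L (λ M → ∑ L (λ B' → v A B M A' B')))))
      ≈⟨ ∑-comm L L _ ⟩
    ∑ L (λ A' → ∑ L (λ A → ∑ L (λ B → ∑ L (λ M → ∑ L (λ B' → v A B M A' B')))))
      ≈⟨ ∑-cong L (λ A' → ∑-cong L λ A → ∑-cong L λ B → ∑-comm L L _) ⟩
    ∑ L (λ A' → ∑ L (λ A → ∑ L (λ B → ∑ L (λ B' → ∑ L (λ M → v A B M A' B')))))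
      ≈⟨ ∑-cong L (λ A' → ∑-cong L λ A → ∑-comm L L _) ⟩
    ∑ L (λ A' → ∑ L (λ A → ∑ L (λ B' → ∑ L (λ B → ∑ L (λ M → v A B M A' B')))))
      ≈⟨ ∑-cong L (λ A' → ∑-comm L L _) ⟩
    ∑ L (λ A' → ∑ L (λ B' → ∑ L (λ A → ∑ L (λ B → ∑ L (λ M → v A B M A' B')))))
      ≈⟨ ∑-cong L (λ A' → ∑-cong L λ B' → sym (trans (∑-* L _ _) (∑-cong L λ A → trans (∑-* L _ _) (∑-cong L λ B → ∑-* L _ _)))) ⟩
    ∑ L (λ A' → ∑ L (λ B' → ∑³ (λ A B M → α A B * w A B M A' B') * D A' B')) ∎
    where
    L = allLabels k
    w : Label k → Label k → Label k → Label k → Label k → Carrier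
    w A B M A' B' = w₁ I A M A' * w₂ M B K B'
    D : Label k → Label k → Carrier
    D A' B' = strip w₁ w₂ A' B' Is Ks
    v : Label k → Label k → Label k → Label k → Label k → Carrier
    v A B M A' B' = (α A B * w A B M A' B') * D A' B'

  twoRows : ∀ {k W} → VertexWeight R k → VertexWeight R k → Vec (Label k) W → Vec (Label k) W → Carrier
  twoRows {k} {W} w₁ w₂ Bs Ts = ∑ (allVecs (allLabels k) W) λ Ss → rowW R w₁ emptyLabel Bs Ss * rowW R w₂ emptyLabel Ss Ts

  Z-∷-∷ : ∀ {k W} (w₁ w₂ : VertexWeight R k) ws (Bs Ts : Vec (Label k) W) →
    Z R (w₁ List.∷ w₂ List.∷ ws) Bs Ts ≈ ∑ (allVecs (allLabels k) W) (λ Ss → twoRows w₁ w₂ Bs Ss * Z R ws Ss Ts)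
  Z-∷-∷ {k} {W} w₁ w₂ ws Bs Ts = begin
    ∑ Vs (λ Ss → rowW R w₁ emptyLabel Bs Ss * ∑ Vs (λ Ss′ → rowW R w₂ emptyLabel Ss Ss′ * Z R ws Ss′ Ts))
      ≈⟨ ∑-cong Vs (λ Ss → trans (*-∑ Vs _ _) (∑-cong Vs λ Ss′ → sym (*-assoc _ _ _))) ⟩
    ∑ Vs (λ Ss → ∑ Vs (λ Ss′ → (rowW R w₁ emptyLabel Bs Ss * rowW R w₂ emptyLabel Ss Ss′) * Z R ws Ss′ Ts))
      ≈⟨ ∑-comm Vs Vs _ ⟩
    ∑ Vs (λ Ss′ → ∑ Vs (λ Ss → (rowW R w₁ emptyLabel Bs Ss * rowW R w₂ emptyLabel Ss Ss′) * Z R ws Ss′ Ts))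
      ≈⟨ ∑-cong Vs (λ Ss′ → sym (∑-* Vs _ _)) ⟩
    ∑ Vs (λ Ss′ → twoRows w₁ w₂ Bs Ss′ * Z R ws Ss′ Ts) ∎
    where Vs = allVecs (allLabels k) W

  Z-swap : ∀ {k W} (w₁ w₂ : VertexWeight R k) → (∀ (Bs Ts : Vec (Label k) W) → twoRows w₁ w₂ Bs Ts ≈ twoRows w₂ w₁ Bs Ts) →
    ∀ ws (Bs Ts : Vec (Label k) W) → Z R (w₁ List.∷ w₂ List.∷ ws) Bs Ts ≈ Z R (w₂ List.∷ w₁ List.∷ ws) Bs Ts
  Z-swap {k} {W} w₁ w₂ commute ws Bs Ts =
    trans (Z-∷-∷ w₁ w₂ ws Bs Ts) (trans (∑-cong (allVecs (allLabels k) W) (λ Ss → *-cong (commute Bs Ss) refl))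
                                        (sym (Z-∷-∷ w₂ w₁ ws Bs Ts)))

  Z-cancel : ∀ {k W} (w₁ w₂ : VertexWeight R k) → (∀ (Bs Ts : Vec (Label k) W) → twoRows w₁ w₂ Bs Ts ≈ χ≡ᵥ Bs Ts) →
    ∀ ws (Bs Ts : Vec (Label k) W) → Z R (w₁ List.∷ w₂ List.∷ ws) Bs Ts ≈ Z R ws Bs Ts
  Z-cancel {k} {W} w₁ w₂ cancel ws Bs Ts =
    trans (Z-∷-∷ w₁ w₂ ws Bs Ts) (trans (∑-cong (allVecs (allLabels k) W) (λ Ss → *-cong (cancel Bs Ss) refl))
                                        (∑-χ≡ᵥ Bs (λ Ss → Z R ws Ss Ts)))

  Z-++-congˡ : ∀ {k W} (ws : List (VertexWeight R k)) {us vs : List (VertexWeight R k)} →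
    (∀ (Bs Ts : Vec (Label k) W) → Z R us Bs Ts ≈ Z R vs Bs Ts) →
    ∀ (Bs Ts : Vec (Label k) W) → Z R (ws List.++ us) Bs Ts ≈ Z R (ws List.++ vs) Bs Ts
  Z-++-congˡ List.[] us≈vs Bs Ts = us≈vs Bs Ts
  Z-++-congˡ {k} {W} (w List.∷ ws) us≈vs Bs Ts = ∑-cong (allVecs (allLabels k) W) (λ Ss → *-cong refl (Z-++-congˡ ws us≈vs Ss Ts))

  module Train (t x y : Carrier) where

    whiteˣ purpleˣ : ℕ → ∀ {k} → Label k → Label k → Label k → Label k → Carrier
    whiteˣ = vertexˣ t whiteRule whiteExp x
    purpleˣ = vertexˣ t purpleRule purpleExp y

    split : ∀ {k} → Label k → Label k → Label k → Carrier
    split [] [] [] = 1#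
    split (c ∷ C) (a ∷ A) (b ∷ B) = split₁ x y c a b (t ^ size C) * split C A B

    splitˣ : ℕ → ∀ {k} → Label k → Label k → Label k → Carrier
    splitˣ acc [] [] [] = 1#
    splitˣ acc (c ∷ C) (a ∷ A) (b ∷ B) = split₁′ x y c a b (t ^ acc) * splitˣ (acc ℕ.+ b2n a) C A B

    coeffWP coeffPW : ℕ → ∀ {k} → Label k → Label k → Label k → Carrier
    coeffWP pre [] [] [] = 1#
    coeffWP pre (c ∷ C) (i ∷ I) (k ∷ K) =
      coeffWP₁ x y c i k (t ^ pre) (t ^ size C) * coeffWP (b2n (carry c i k) ℕ.+ pre) C I K
    coeffPW pre [] [] [] = 1#
    coeffPW pre (c ∷ C) (i ∷ I) (k ∷ K) =
      coeffPW₁ x y c i k (t ^ pre) (t ^ size C) * coeffPW (b2n (carry c i k) ℕ.+ pre) C I K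

    column-WP : ∀ {k} accA accB (C I K A' B' : Label k) →
      ∑³ (λ A B M → split C A B * (whiteˣ accA I A M A' * purpleˣ accB M B K B'))
      ≈ coeffWP (accA ℕ.+ accB) C I K * splitˣ accA (carryᵥ C I K) A' B'
    column-WP accA accB [] [] [] [] [] =
      trans (∑³-zero λ A B M → split [] A B * (whiteˣ accA [] A M [] * purpleˣ accB M B [] [])) (*-identityˡ _)
    column-WP accA accB (c ∷ C) (i ∷ I) (k ∷ K) (a' ∷ A') (b' ∷ B') = begin
      ∑³ (λ A B M → split (c ∷ C) A B * (whiteˣ accA (i ∷ I) A M (a' ∷ A') * purpleˣ accB M B (k ∷ K) (b' ∷ B')))
        ≈⟨ ∑³-suc (λ A B M → split (c ∷ C) A B * (whiteˣ accA (i ∷ I) A M (a' ∷ A') * purpleˣ accB M B (k ∷ K) (b' ∷ B'))) ⟩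
      Σ𝔹³ (λ a b m → ∑³ (λ A B M → (split₁ x y c a b TR * split C A B)
                          * ((white₁ x TA i a m a' * whiteˣ (accA ℕ.+ b2n a') I A M A')
                             * (purple₁ y TB m b k b' * purpleˣ (accB ℕ.+ b2n b') M B K B'))))
        ≈⟨ Σ𝔹³-cong (λ a b m → trans (∑³-cong λ A B M → interchange (split₁ x y c a b TR) (split C A B)
                        (white₁ x TA i a m a') (whiteˣ (accA ℕ.+ b2n a') I A M A')
                        (purple₁ y TB m b k b') (purpleˣ (accB ℕ.+ b2n b') M B K B')) (∑³-*ˡ (f a b m) (G a' b'))) ⟩
      Σ𝔹³ (λ a b m → f a b m * ∑³ (G a' b'))
        ≈⟨ Σ𝔹³-cong (λ a b m → *-cong (refl {f a b m}) (column-WP (accA ℕ.+ b2n a') (accB ℕ.+ b2n b') C I K A' B')) ⟩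
      Σ𝔹³ (λ a b m → f a b m * (coeffWP ((accA ℕ.+ b2n a') ℕ.+ (accB ℕ.+ b2n b')) C I K * S))
        ≈⟨ Σ𝔹³-*ʳ f _ ⟩
      Σ𝔹³ f * (coeffWP ((accA ℕ.+ b2n a') ℕ.+ (accB ℕ.+ b2n b')) C I K * S)
        ≈⟨ *-cong (column-split c i k a' b' x y TA TB TR)
                  (*-cong (reflexive (≡.cong (λ n → coeffWP n C I K) (+-+-shuffle accA accB (b2n a') (b2n b')))) refl) ⟩
      (coeffWP₁ x y c i k (TA * TB) TR * split₁′ x y c' a' b' TA) * (κ (b2n a' ℕ.+ b2n b') * S)
        ≈⟨ trans (regroup _ _ _ _) (*-cong refl (*-cong (split₁′-support x y c' a' b' TA κ) refl)) ⟩
      coeffWP₁ x y c i k (TA * TB) TR * ((split₁′ x y c' a' b' TA * κ (b2n c')) * S)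
        ≈⟨ trans (regroup′ _ _ _ _) (*-cong (*-cong (coeffWP₁-cong x y c i k TR (sym (^-homo-* t accA accB))) refl) refl) ⟩
      (coeffWP₁ x y c i k (t ^ (accA ℕ.+ accB)) TR * κ (b2n c')) * (split₁′ x y c' a' b' TA * S) ∎
      where
      TA = t ^ accA
      TB = t ^ accB
      TR = t ^ size C
      c' = carry c i k
      S = splitˣ (accA ℕ.+ b2n a') (carryᵥ C I K) A' B'
      κ : ℕ → Carrier
      κ n = coeffWP (n ℕ.+ (accA ℕ.+ accB)) C I K
      f : Bool → Bool → Bool → Carrier
      f a b m = split₁ x y c a b TR * (white₁ x TA i a m a' * purple₁ y TB m b k b')
      G : Bool → Bool → Label _ → Label _ → Label _ → Carrier
      G a' b' A B M = split C A B * (whiteˣ (accA ℕ.+ b2n a') I A M A' * purpleˣ (accB ℕ.+ b2n b') M B K B')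
      interchange : ∀ s₁ s w₁ w p₁ p → (s₁ * s) * ((w₁ * w) * (p₁ * p)) ≈ (s₁ * (w₁ * p₁)) * (s * (w * p))
      interchange = solve 6 (λ s₁ s w₁ w p₁ p → (s₁ :* s) :* ((w₁ :* w) :* (p₁ :* p)) := (s₁ :* (w₁ :* p₁)) :* (s :* (w :* p))) refl
      regroup : ∀ u v w z → (u * v) * (w * z) ≈ u * ((v * w) * z)
      regroup = solve 4 (λ u v w z → (u :* v) :* (w :* z) := u :* ((v :* w) :* z)) refl
      regroup′ : ∀ u v w z → u * ((v * w) * z) ≈ (u * w) * (v * z)
      regroup′ = solve 4 (λ u v w z → u :* ((v :* w) :* z) := (u :* w) :* (v :* z)) refl

    column-PW : ∀ {k} aP aQ (p q I K : Label k) (F : Label k → Carrier) →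
      ∑³ (λ M p' q' → (purpleˣ aP I p M p' * whiteˣ aQ M q K q') * (disjoint p' q' * F (p' ∨ᵥ q')))
      ≈ disjoint p q * (t ^ (aQ ℕ.* size (p ∨ᵥ q)) * (coeffPW (aP ℕ.+ aQ) (p ∨ᵥ q) I K * F (carryᵥ (p ∨ᵥ q) I K)))
    column-PW aP aQ [] [] [] [] F =
      trans (∑³-zero λ M p' q' → (purpleˣ aP [] [] M p' * whiteˣ aQ M [] [] q') * (disjoint p' q' * F (p' ∨ᵥ q')))
            (trans (*-cong (*-identityˡ 1#) refl)
                   (sym (*-cong refl (trans (*-cong (reflexive (≡.cong (t ^_) (ℕP.*-zeroʳ aQ))) refl) (*-identityˡ _)))))
    column-PW aP aQ (p ∷ P) (q ∷ Q) (i ∷ I) (k ∷ K) F = begin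
      ∑³ (λ M p' q' → (purpleˣ aP (i ∷ I) (p ∷ P) M p' * whiteˣ aQ M (q ∷ Q) (k ∷ K) q') * (disjoint p' q' * F (p' ∨ᵥ q')))
        ≈⟨ ∑³-suc (λ M p' q' → (purpleˣ aP (i ∷ I) (p ∷ P) M p' * whiteˣ aQ M (q ∷ Q) (k ∷ K) q') * (disjoint p' q' * F (p' ∨ᵥ q'))) ⟩
      Σ𝔹³ (λ m p' q' → ∑³ (λ M P' Q' →
        ((purple₁ y TP i p m p' * purpleˣ (aP ℕ.+ b2n p') I P M P') * (white₁ x TQ m q k q' * whiteˣ (aQ ℕ.+ b2n q') M Q K Q'))
        * ((disjoint₁ p' q' * disjoint P' Q') * F ((p' ∨ q') ∷ (P' ∨ᵥ Q')))))
        ≈⟨ Σ𝔹³-cong (λ m p' q' → trans (∑³-cong λ M P' Q' → interchange (purple₁ y TP i p m p') (purpleˣ (aP ℕ.+ b2n p') I P M P')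
                                                                        (white₁ x TQ m q k q') (whiteˣ (aQ ℕ.+ b2n q') M Q K Q')
                                                                        (disjoint₁ p' q') (disjoint P' Q') (F ((p' ∨ q') ∷ (P' ∨ᵥ Q'))))
                                       (trans (∑³-*ˡ (f m p' q') (λ M P' Q' → disjoint₁ p' q' * G p' q' M P' Q'))
                                              (*-cong refl (∑³-*ˡ (disjoint₁ p' q') (G p' q'))))) ⟩
      Σ𝔹³ (λ m p' q' → f m p' q' * (disjoint₁ p' q' * ∑³ (G p' q')))
        ≈⟨ Σ𝔹³-cong (λ m p' q' → *-cong (refl {f m p' q'}) (*-cong (refl {disjoint₁ p' q'})
             (column-PW (aP ℕ.+ b2n p') (aQ ℕ.+ b2n q') P Q I K (λ D → F ((p' ∨ q') ∷ D))))) ⟩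
      Σ𝔹³ (λ m p' q' → f m p' q' * (disjoint₁ p' q' * (disjoint P Q * (t ^ ((aQ ℕ.+ b2n q') ℕ.* size U)
                          * (coeffPW ((aP ℕ.+ b2n p') ℕ.+ (aQ ℕ.+ b2n q')) U I K * F ((p' ∨ q') ∷ C'))))))
        ≈⟨ Σ𝔹³-cong (λ m p' q' → trans (*-cong (refl {f m p' q'}) (merge-twists p' q')) (sym (*-assoc _ _ _))) ⟩
      Σ𝔹³ (λ m p' q' → (f m p' q' * (disjoint₁ p' q' * (TR ^ b2n q' * H (p' ∨ q')))) * W)
        ≈⟨ Σ𝔹³-*ʳ (λ m p' q' → f m p' q' * (disjoint₁ p' q' * (TR ^ b2n q' * H (p' ∨ q')))) W ⟩
      Σ𝔹³ (λ m p' q' → f m p' q' * (disjoint₁ p' q' * (TR ^ b2n q' * H (p' ∨ q')))) * W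
        ≈⟨ *-cong (column-merge p q i k x y TP TQ TR H) refl ⟩
      (disjoint₁ p q * (TQ ^ b2n (p ∨ q) * (coeffPW₁ x y (p ∨ q) i k (TP * TQ) TR * H c'))) * W
        ≈⟨ regroup _ _ _ _ _ _ _ ⟩
      (disjoint₁ p q * disjoint P Q) * ((TQ ^ b2n (p ∨ q) * t ^ (aQ ℕ.* size U))
        * ((coeffPW₁ x y (p ∨ q) i k (TP * TQ) TR * coeffPW (b2n c' ℕ.+ (aP ℕ.+ aQ)) U I K) * F (c' ∷ C')))
        ≈⟨ *-cong refl (*-cong (sym (^-*-distribˡ-+ t aQ (b2n (p ∨ q)) (size U)))
                               (*-cong (*-cong (coeffPW₁-cong x y (p ∨ q) i k TR (sym (^-homo-* t aP aQ))) refl) refl)) ⟩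
      (disjoint₁ p q * disjoint P Q) * (t ^ (aQ ℕ.* (b2n (p ∨ q) ℕ.+ size U))
        * ((coeffPW₁ x y (p ∨ q) i k (t ^ (aP ℕ.+ aQ)) TR * coeffPW (b2n c' ℕ.+ (aP ℕ.+ aQ)) U I K) * F (c' ∷ C'))) ∎
      where
      TP = t ^ aP
      TQ = t ^ aQ
      U = P ∨ᵥ Q
      TR = t ^ size U
      C' = carryᵥ U I K
      c' = carry (p ∨ q) i k
      W = disjoint P Q * t ^ (aQ ℕ.* size U)
      f : Bool → Bool → Bool → Carrier
      f m p' q' = purple₁ y TP i p m p' * white₁ x TQ m q k q'
      G : Bool → Bool → Label _ → Label _ → Label _ → Carrier
      G p' q' M P' Q' = (purpleˣ (aP ℕ.+ b2n p') I P M P' * whiteˣ (aQ ℕ.+ b2n q') M Q K Q')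
                        * (disjoint P' Q' * F ((p' ∨ q') ∷ (P' ∨ᵥ Q')))
      H : Bool → Carrier
      H b = coeffPW (b2n b ℕ.+ (aP ℕ.+ aQ)) U I K * F (b ∷ C')
      merge-twists : ∀ p' q' →
        disjoint₁ p' q' * (disjoint P Q * (t ^ ((aQ ℕ.+ b2n q') ℕ.* size U)
          * (coeffPW ((aP ℕ.+ b2n p') ℕ.+ (aQ ℕ.+ b2n q')) U I K * F ((p' ∨ q') ∷ C'))))
        ≈ (disjoint₁ p' q' * (TR ^ b2n q' * H (p' ∨ q'))) * W
      merge-twists p' q' = begin
        disjoint₁ p' q' * Y ((aP ℕ.+ b2n p') ℕ.+ (aQ ℕ.+ b2n q'))
          ≡⟨ ≡.cong (λ n → disjoint₁ p' q' * Y n) (+-+-shuffle aP aQ (b2n p') (b2n q')) ⟩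
        disjoint₁ p' q' * Y ((b2n p' ℕ.+ b2n q') ℕ.+ (aP ℕ.+ aQ))
          ≈⟨ disjoint₁-support p' q' (λ n → Y (n ℕ.+ (aP ℕ.+ aQ))) ⟩
        disjoint₁ p' q' * (disjoint P Q * (t ^ ((aQ ℕ.+ b2n q') ℕ.* size U) * H (p' ∨ q')))
          ≈⟨ *-cong refl (*-cong refl (*-cong (^-*-distribʳ-+ t aQ (b2n q') (size U)) refl)) ⟩
        disjoint₁ p' q' * (disjoint P Q * ((t ^ (aQ ℕ.* size U) * TR ^ b2n q') * H (p' ∨ q')))
          ≈⟨ shuffle _ _ _ _ _ ⟩
        (disjoint₁ p' q' * (TR ^ b2n q' * H (p' ∨ q'))) * W ∎
        where
        Y : ℕ → Carrier
        Y n = disjoint P Q * (t ^ ((aQ ℕ.+ b2n q') ℕ.* size U) * (coeffPW n U I K * F ((p' ∨ q') ∷ C')))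
        shuffle : ∀ d e u v h → d * (e * ((u * v) * h)) ≈ (d * (v * h)) * (e * u)
        shuffle = solve 5 (λ d e u v h → d :* (e :* ((u :* v) :* h)) := (d :* (v :* h)) :* (e :* u)) refl
      interchange : ∀ p₁ p w₁ w d₁ d z → ((p₁ * p) * (w₁ * w)) * ((d₁ * d) * z) ≈ (p₁ * w₁) * (d₁ * ((p * w) * (d * z)))
      interchange = solve 7 (λ p₁ p w₁ w d₁ d z → ((p₁ :* p) :* (w₁ :* w)) :* ((d₁ :* d) :* z) := (p₁ :* w₁) :* (d₁ :* ((p :* w) :* (d :* z)))) refl
      regroup : ∀ d₁ u τ κ z e v → (d₁ * (u * (τ * (κ * z)))) * (e * v) ≈ (d₁ * e) * ((u * v) * ((τ * κ) * z))
      regroup = solve 7 (λ d₁ u τ κ z e v → (d₁ :* (u :* (τ :* (κ :* z)))) :* (e :* v) := (d₁ :* e) :* ((u :* v) :* ((τ :* κ) :* z))) refl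

    split-χ∅ : ∀ {k} (C : Label k) → split C emptyLabel emptyLabel ≈ χ∅ C
    split-χ∅ [] = refl
    split-χ∅ (false ∷ C) = trans (*-identityˡ _) (split-χ∅ C)
    split-χ∅ (true ∷ C) = zeroˡ _

    split-emptyLabel : ∀ {k} (A B : Label k) → split emptyLabel A B ≈ χ∅ A * χ∅ B
    split-emptyLabel [] [] = sym (*-identityˡ _)
    split-emptyLabel (false ∷ A) (false ∷ B) = trans (*-identityˡ _) (split-emptyLabel A B)
    split-emptyLabel (false ∷ A) (true ∷ B) = trans (zeroˡ _) (sym (zeroʳ _))
    split-emptyLabel (true ∷ A) (b ∷ B) = trans (zeroˡ _) (sym (zeroˡ _))

    ∑-χ∅-χ∅ : ∀ {k} (g : Label k → Label k → Carrier) →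
      ∑ (allLabels k) (λ A → ∑ (allLabels k) (λ B → (χ∅ A * χ∅ B) * g A B)) ≈ g emptyLabel emptyLabel
    ∑-χ∅-χ∅ {k} g = begin
      ∑ L (λ A → ∑ L (λ B → (χ∅ A * χ∅ B) * g A B))
        ≈⟨ ∑-cong L (λ A → trans (∑-cong L (λ B → *-assoc _ _ _)) (sym (*-∑ L (χ∅ A) (λ B → χ∅ B * g A B)))) ⟩
      ∑ L (λ A → χ∅ A * ∑ L (λ B → χ∅ B * g A B))
        ≈⟨ ∑-χ∅ (λ A → ∑ L (λ B → χ∅ B * g A B)) ⟩
      ∑ L (λ B → χ∅ B * g emptyLabel B)
        ≈⟨ ∑-χ∅ (g emptyLabel) ⟩
      g emptyLabel emptyLabel ∎
      where L = allLabels k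

    ∑-split-emptyLabel : ∀ {k} (g : Label k → Label k → Carrier) →
      ∑ (allLabels k) (λ A → ∑ (allLabels k) (λ B → split emptyLabel A B * g A B)) ≈ g emptyLabel emptyLabel
    ∑-split-emptyLabel {k} g =
      trans (∑-cong L (λ A → ∑-cong L (λ B → *-cong (split-emptyLabel A B) refl))) (∑-χ∅-χ∅ g)
      where L = allLabels k

    ∑-split-χ∅-χ∅ : ∀ {k} (C : Label k) →
      ∑ (allLabels k) (λ A → ∑ (allLabels k) (λ B → split C A B * (χ∅ A * χ∅ B))) ≈ χ∅ C
    ∑-split-χ∅-χ∅ {k} C =
      trans (∑-cong L (λ A → ∑-cong L (λ B → *-comm _ _))) (trans (∑-χ∅-χ∅ (split C)) (split-χ∅ C))
      where L = allLabels k

    splitˣ-split : ∀ {k} acc (C A B : Label k) → splitˣ acc C A B ≈ t ^ (acc ℕ.* size C) * split C A B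
    splitˣ-split acc [] [] [] = sym (trans (*-cong (reflexive (≡.cong (t ^_) (ℕP.*-zeroʳ acc))) refl) (*-identityˡ _))
    splitˣ-split acc (c ∷ C) (a ∷ A) (b ∷ B) =
      trans (*-cong refl (splitˣ-split (acc ℕ.+ b2n a) C A B)) (by-cases c a b)
      where
      S = split C A B
      n = size C
      powʳ : ∀ a → t ^ ((acc ℕ.+ b2n a) ℕ.* n) ≈ t ^ (acc ℕ.* n) * (t ^ n) ^ b2n a
      powʳ a = ^-*-distribʳ-+ t acc (b2n a) n
      powˡ : t ^ (acc ℕ.* (1 ℕ.+ n)) ≈ (t ^ acc) ^ 1 * t ^ (acc ℕ.* n)
      powˡ = ^-*-distribˡ-+ t acc 1 n
      by-cases : ∀ c a b →
        split₁′ x y c a b (t ^ acc) * (t ^ ((acc ℕ.+ b2n a) ℕ.* n) * S)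
        ≈ t ^ (acc ℕ.* (b2n c ℕ.+ n)) * (split₁ x y c a b (t ^ n) * S)
      by-cases false false false = begin
        1# * (t ^ ((acc ℕ.+ 0) ℕ.* n) * S)   ≈⟨ *-identityˡ _ ⟩
        t ^ ((acc ℕ.+ 0) ℕ.* n) * S          ≡⟨ ≡.cong (λ m → t ^ (m ℕ.* n) * S) (ℕP.+-identityʳ acc) ⟩
        t ^ (acc ℕ.* n) * S                  ≈⟨ *-cong refl (sym (*-identityˡ _)) ⟩
        t ^ (acc ℕ.* n) * (1# * S)           ∎
      by-cases true true false = begin
        (x * t ^ acc) * (t ^ ((acc ℕ.+ 1) ℕ.* n) * S)          ≈⟨ *-cong refl (*-cong (powʳ true) refl) ⟩
        (x * t ^ acc) * ((t ^ (acc ℕ.* n) * (t ^ n) ^ 1) * S)  ≈⟨ regroup _ _ _ _ _ ⟩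
        ((t ^ acc) ^ 1 * t ^ (acc ℕ.* n)) * ((x * t ^ n) * S)  ≈⟨ *-cong (sym powˡ) refl ⟩
        t ^ (acc ℕ.* (1 ℕ.+ n)) * ((x * t ^ n) * S)            ∎
        where
        regroup : ∀ x a b c s → (x * a) * ((b * (c * 1#)) * s) ≈ (a * 1#) * b * ((x * c) * s)
        regroup = solve 5 (λ x a b c s → (x :* a) :* ((b :* (c :* con 1)) :* s) := (a :* con 1) :* b :* ((x :* c) :* s)) refl
      by-cases true false true = begin
        (y * t ^ acc) * (t ^ ((acc ℕ.+ 0) ℕ.* n) * S)          ≈⟨ *-cong refl (*-cong (powʳ false) refl) ⟩
        (y * t ^ acc) * ((t ^ (acc ℕ.* n) * (t ^ n) ^ 0) * S)  ≈⟨ regroup _ _ _ _ ⟩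
        ((t ^ acc) ^ 1 * t ^ (acc ℕ.* n)) * (y * S)            ≈⟨ *-cong (sym powˡ) refl ⟩
        t ^ (acc ℕ.* (1 ℕ.+ n)) * (y * S)                      ∎
        where
        regroup : ∀ y a b s → (y * a) * ((b * 1#) * s) ≈ (a * 1#) * b * (y * s)
        regroup = solve 4 (λ y a b s → (y :* a) :* ((b :* con 1) :* s) := (a :* con 1) :* b :* (y :* s)) refl
      by-cases false false true = trans (zeroˡ _) (sym (trans (*-cong refl (zeroˡ _)) (zeroʳ _)))
      by-cases false true  b    = trans (zeroˡ _) (sym (trans (*-cong refl (zeroˡ _)) (zeroʳ _)))
      by-cases true  false false = trans (zeroˡ _) (sym (trans (*-cong refl (zeroˡ _)) (zeroʳ _)))
      by-cases true  true  true  = trans (zeroˡ _) (sym (trans (*-cong refl (zeroˡ _)) (zeroʳ _)))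

    poch : ℕ → Carrier → Carrier
    poch zero z = 1#
    poch (suc n) z = (y + z) * poch n (t * z)

    poch-cong : ∀ n {z z'} → z ≈ z' → poch n z ≈ poch n z'
    poch-cong zero z≈z' = refl
    poch-cong (suc n) z≈z' = *-cong (+-cong refl z≈z') (poch-cong n (*-cong refl z≈z'))

    poch-suc-last : ∀ n z → poch (suc n) z ≈ poch n z * (y + t ^ n * z)
    poch-suc-last zero z = trans (*-identityʳ _) (sym (trans (*-identityˡ _) (+-cong refl (*-identityˡ z))))
    poch-suc-last (suc n) z = begin
      (y + z) * poch (suc n) (t * z)                ≈⟨ *-cong refl (poch-suc-last n (t * z)) ⟩
      (y + z) * (poch n (t * z) * (y + t ^ n * (t * z))) ≈⟨ regroup y z (poch n (t * z)) (t ^ n) t ⟩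
      ((y + z) * poch n (t * z)) * (y + (t * t ^ n) * z) ∎
      where
      regroup : ∀ y z p u t → (y + z) * (p * (y + u * (t * z))) ≈ ((y + z) * p) * (y + (t * u) * z)
      regroup = solve 5 (λ y z p u t → (y :+ z) :* (p :* (y :+ u :* (t :* z))) := ((y :+ z) :* p) :* (y :+ (t :* u) :* z)) refl

    poch-intertwines : ∀ {k} pre (C I K : Label k) →
      poch (size C) (x * t ^ pre) * coeffPW pre C I K ≈ coeffWP pre C I K * poch (size (carryᵥ C I K)) (x * t ^ pre)
    poch-intertwines pre [] [] [] = trans (*-identityˡ _) (sym (*-identityʳ _))
    poch-intertwines pre (c ∷ C) (i ∷ I) (k ∷ K) = by-cases c i k
      where
      z = x * t ^ pre
      n = size C
      n' = size (carryᵥ C I K)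
      τ = coeffPW pre C I K
      κ = coeffWP pre C I K
      τ' = coeffPW (suc pre) C I K
      κ' = coeffWP (suc pre) C I K
      ih : poch n z * τ ≈ κ * poch n' z
      ih = poch-intertwines pre C I K
      z-shift : x * t ^ suc pre ≈ t * z
      z-shift = solve 3 (λ x t p → x :* (t :* p) := t :* (x :* p)) refl x t (t ^ pre)
      ih-shifted : poch n (t * z) * τ' ≈ κ' * poch n' (t * z)
      ih-shifted = trans (*-cong (poch-cong n (sym z-shift)) refl)
                         (trans (poch-intertwines (suc pre) C I K) (*-cong refl (poch-cong n' z-shift)))
      carried : ∀ u → ((y + z) * poch n (t * z)) * (u * τ') ≈ (u * κ') * ((y + z) * poch n' (t * z))
      carried u = begin
        ((y + z) * poch n (t * z)) * (u * τ') ≈⟨ regroup _ _ _ _ ⟩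
        ((y + z) * u) * (poch n (t * z) * τ') ≈⟨ *-cong refl ih-shifted ⟩
        ((y + z) * u) * (κ' * poch n' (t * z)) ≈⟨ regroup′ _ _ _ _ ⟩
        (u * κ') * ((y + z) * poch n' (t * z)) ∎
        where
        regroup : ∀ a p u c → (a * p) * (u * c) ≈ (a * u) * (p * c)
        regroup = solve 4 (λ a p u c → (a :* p) :* (u :* c) := (a :* u) :* (p :* c)) refl
        regroup′ : ∀ a u k p → (a * u) * (k * p) ≈ (u * k) * (a * p)
        regroup′ = solve 4 (λ a u k p → (a :* u) :* (k :* p) := (u :* k) :* (a :* p)) refl
      by-cases : ∀ c i k →
        poch (size (c ∷ C)) z * coeffPW pre (c ∷ C) (i ∷ I) (k ∷ K)
        ≈ coeffWP pre (c ∷ C) (i ∷ I) (k ∷ K) * poch (size (carryᵥ (c ∷ C) (i ∷ I) (k ∷ K))) z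
      by-cases false false false = trans (*-cong refl (*-identityˡ _)) (trans ih (*-cong (sym (*-identityˡ _)) refl))
      by-cases false false true = trans (*-cong refl (zeroˡ _)) (trans (zeroʳ _) (sym (trans (*-cong (zeroˡ _) refl) (zeroˡ _))))
      by-cases false true true = begin
        poch n z * (t ^ pre * τ) ≈⟨ x∙yz≈y∙xz _ _ _ ⟩
        t ^ pre * (poch n z * τ) ≈⟨ *-cong refl ih ⟩
        t ^ pre * (κ * poch n' z) ≈⟨ sym (*-assoc _ _ _) ⟩
        (t ^ pre * κ) * poch n' z ∎
      by-cases false true false = begin
        poch n z * ((y + x * (t ^ pre * t ^ n)) * τ') ≈⟨ regroup (poch n z) y x (t ^ pre) (t ^ n) τ' ⟩
        (poch n z * (y + t ^ n * z)) * τ'            ≈⟨ *-cong (sym (poch-suc-last n z)) refl ⟩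
        ((y + z) * poch n (t * z)) * τ'               ≈⟨ *-assoc _ _ _ ⟩
        (y + z) * (poch n (t * z) * τ')               ≈⟨ *-cong refl ih-shifted ⟩
        (y + z) * (κ' * poch n' (t * z))              ≈⟨ trans (x∙yz≈y∙xz _ _ _) (*-cong (sym (*-identityˡ _)) refl) ⟩
        (1# * κ') * ((y + z) * poch n' (t * z))       ∎
        where
        regroup : ∀ q y x p r τ → q * ((y + x * (p * r)) * τ) ≈ (q * (y + r * (x * p))) * τ
        regroup = solve 6 (λ q y x p r τ → q :* ((y :+ x :* (p :* r)) :* τ) := (q :* (y :+ r :* (x :* p))) :* τ) refl
      by-cases true false false = carried (x * t ^ n)
      by-cases true true true = carried y
      by-cases true false true = begin
        ((y + z) * poch n (t * z)) * (1# * τ) ≈⟨ *-cong (poch-suc-last n z) (*-identityˡ _) ⟩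
        (poch n z * (y + t ^ n * z)) * τ      ≈⟨ trans (*-cong (*-comm _ _) refl) (*-assoc _ _ _) ⟩
        (y + t ^ n * z) * (poch n z * τ)      ≈⟨ *-cong refl ih ⟩
        (y + t ^ n * z) * (κ * poch n' z)     ≈⟨ regroup y (t ^ n) x (t ^ pre) κ (poch n' z) ⟩
        ((y + x * (t ^ n * t ^ pre)) * κ) * poch n' z ∎
        where
        regroup : ∀ y r x p κ q → (y + r * (x * p)) * (κ * q) ≈ ((y + x * (r * p)) * κ) * q
        regroup = solve 6 (λ y r x p κ q → (y :+ r :* (x :* p)) :* (κ :* q) := ((y :+ x :* (r :* p)) :* κ) :* q) refl
      by-cases true true false = trans (*-cong refl (zeroˡ _)) (trans (zeroʳ _) (sym (trans (*-cong (zeroˡ _) refl) (zeroˡ _))))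

    coeffWP-cancels : y ≈ - x → ∀ {k} (C I K : Label k) → coeffWP 0 C I K * χ∅ (carryᵥ C I K) ≈ χ∅ C * χ≡ I K
    coeffWP-cancels y≈-x [] [] [] = refl
    coeffWP-cancels y≈-x (false ∷ C) (false ∷ I) (false ∷ K) = trans (*-cong (*-identityˡ _) refl) (coeffWP-cancels y≈-x C I K)
    coeffWP-cancels y≈-x (false ∷ C) (true ∷ I) (true ∷ K) = trans (*-cong (*-identityˡ _) refl) (coeffWP-cancels y≈-x C I K)
    coeffWP-cancels y≈-x (false ∷ C) (false ∷ I) (true ∷ K) = trans (*-cong (zeroˡ _) refl) (trans (zeroˡ _) (sym (zeroʳ _)))
    coeffWP-cancels y≈-x (false ∷ C) (true ∷ I) (false ∷ K) = trans (zeroʳ _) (sym (zeroʳ _))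
    coeffWP-cancels y≈-x (true ∷ C) (false ∷ I) (false ∷ K) = trans (zeroʳ _) (sym (zeroˡ _))
    coeffWP-cancels y≈-x (true ∷ C) (true ∷ I) (false ∷ K) = trans (zeroʳ _) (sym (zeroˡ _))
    coeffWP-cancels y≈-x (true ∷ C) (true ∷ I) (true ∷ K) = trans (zeroʳ _) (sym (zeroˡ _))
    coeffWP-cancels y≈-x (true ∷ C) (false ∷ I) (true ∷ K) = begin
      (u * coeffWP 0 C I K) * χ∅ (carryᵥ C I K) ≈⟨ *-assoc _ _ _ ⟩
      u * (coeffWP 0 C I K * χ∅ (carryᵥ C I K)) ≈⟨ *-cong refl (coeffWP-cancels y≈-x C I K) ⟩
      u * (χ∅ C * χ≡ I K)                       ≈⟨ sym (*-assoc _ _ _) ⟩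
      (u * χ∅ C) * χ≡ I K                       ≈⟨ trans (*-cong (u∙χ∅≈0 C) refl) (zeroˡ _) ⟩
      0#                                        ≈⟨ sym (zeroˡ _) ⟩
      χ∅ (true ∷ C) * χ≡ (false ∷ I) (true ∷ K) ∎
      where
      u = y + x * (t ^ size C * 1#)
      u∙χ∅≈0 : ∀ {k} (C : Label k) → (y + x * (t ^ size C * 1#)) * χ∅ C ≈ 0#
      u∙χ∅≈0 C with isEmpty C in empty
      ... | false = zeroʳ _
      ... | true = begin
        (y + x * (t ^ size C * 1#)) * 1# ≈⟨ *-identityʳ _ ⟩
        y + x * (t ^ size C * 1#)        ≡⟨ ≡.cong (λ n → y + x * (t ^ n * 1#)) (isEmpty⇒size≡0 C empty) ⟩
        y + x * (1# * 1#)                ≈⟨ +-cong y≈-x (trans (*-cong refl (*-identityˡ _)) (*-identityʳ _)) ⟩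
        - x + x                          ≈⟨ -‿inverseˡ x ⟩
        0#                               ∎

    𝕎 ℙ : ∀ {k} → VertexWeight R k
    𝕎 = white R t x
    ℙ = purple R t y

    splitStrip : ∀ {k W} → Label k → Vec (Label k) W → Vec (Label k) W → Carrier
    splitStrip {k} C Is Ks = ∑ (allLabels k) λ A → ∑ (allLabels k) λ B → split C A B * strip 𝕎 ℙ A B Is Ks

    splitStrip-∷ : ∀ {k W} (C I K : Label k) (Is Ks : Vec (Label k) W) →
      splitStrip C (I ∷ Is) (K ∷ Ks) ≈ coeffWP 0 C I K * splitStrip (carryᵥ C I K) Is Ks
    splitStrip-∷ {k} C I K Is Ks = begin
      splitStrip C (I ∷ Is) (K ∷ Ks)
        ≈⟨ ∑-strip-∷ (split C) 𝕎 ℙ I K Is Ks ⟩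
      ∑ L (λ A' → ∑ L (λ B' → ∑³ (λ A B M → split C A B * (𝕎 I A M A' * ℙ M B K B')) * strip 𝕎 ℙ A' B' Is Ks))
        ≈⟨ ∑-cong L (λ A' → ∑-cong L λ B' → *-cong (trans
             (∑³-cong λ A B M → *-cong refl (*-cong (white-factorises t x I A M A') (purple-factorises t y M B K B')))
             (column-WP 0 0 C I K A' B')) refl) ⟩
      ∑ L (λ A' → ∑ L (λ B' → (coeffWP 0 C I K * splitˣ 0 C' A' B') * strip 𝕎 ℙ A' B' Is Ks))
        ≈⟨ ∑-cong L (λ A' → ∑-cong L λ B' →
             trans (*-assoc _ _ _) (*-cong refl (*-cong (trans (splitˣ-split 0 C' A' B') (*-identityˡ _)) refl))) ⟩
      ∑ L (λ A' → ∑ L (λ B' → coeffWP 0 C I K * (split C' A' B' * strip 𝕎 ℙ A' B' Is Ks)))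
        ≈⟨ sym (trans (*-∑ L _ _) (∑-cong L λ A' → *-∑ L _ _)) ⟩
      coeffWP 0 C I K * splitStrip C' Is Ks ∎
      where
      L = allLabels k
      C' = carryᵥ C I K

    splitStrip-cancels : y ≈ - x → ∀ {k W} (C : Label k) (Is Ks : Vec (Label k) W) → splitStrip C Is Ks ≈ χ∅ C * χ≡ᵥ Is Ks
    splitStrip-cancels y≈-x C [] [] = trans (∑-split-χ∅-χ∅ C) (sym (*-identityʳ _))
    splitStrip-cancels y≈-x C (I ∷ Is) (K ∷ Ks) = begin
      splitStrip C (I ∷ Is) (K ∷ Ks)                  ≈⟨ splitStrip-∷ C I K Is Ks ⟩
      coeffWP 0 C I K * splitStrip C' Is Ks           ≈⟨ *-cong refl (splitStrip-cancels y≈-x C' Is Ks) ⟩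
      coeffWP 0 C I K * (χ∅ C' * χ≡ᵥ Is Ks)           ≈⟨ sym (*-assoc _ _ _) ⟩
      (coeffWP 0 C I K * χ∅ C') * χ≡ᵥ Is Ks           ≈⟨ *-cong (coeffWP-cancels y≈-x C I K) refl ⟩
      (χ∅ C * χ≡ I K) * χ≡ᵥ Is Ks                     ≈⟨ *-assoc _ _ _ ⟩
      χ∅ C * χ≡ᵥ (I ∷ Is) (K ∷ Ks)                    ∎
      where C' = carryᵥ C I K

    strip-PW-∷ : ∀ {k W} (Is Ks : Vec (Label k) W) →
      (∀ p' q' → strip ℙ 𝕎 p' q' Is Ks ≈ disjoint p' q' * strip ℙ 𝕎 (p' ∨ᵥ q') emptyLabel Is Ks) →
      ∀ (p q I K : Label k) →
      strip ℙ 𝕎 p q (I ∷ Is) (K ∷ Ks)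
      ≈ disjoint p q * (coeffPW 0 (p ∨ᵥ q) I K * strip ℙ 𝕎 (carryᵥ (p ∨ᵥ q) I K) emptyLabel Is Ks)
    strip-PW-∷ Is Ks merged p q I K =
      trans (∑³-cong λ M p' q' → *-cong (*-cong (purple-factorises t y I p M p') (white-factorises t x M q K q')) (merged p' q'))
            (trans (column-PW 0 0 p q I K (λ D → strip ℙ 𝕎 D emptyLabel Is Ks)) (*-cong refl (*-identityˡ _)))

    strip-PW-merge : ∀ {k W} (p q : Label k) (Is Ks : Vec (Label k) W) →
      strip ℙ 𝕎 p q Is Ks ≈ disjoint p q * strip ℙ 𝕎 (p ∨ᵥ q) emptyLabel Is Ks
    strip-PW-merge {k} p q [] [] = trans (χ∅-∨ᵥ p q) (*-cong refl (sym (trans (*-cong refl (χ∅-emptyLabel k)) (*-identityʳ _))))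
    strip-PW-merge p q (I ∷ Is) (K ∷ Ks) = begin
      strip ℙ 𝕎 p q (I ∷ Is) (K ∷ Ks)
        ≈⟨ strip-PW-∷ Is Ks merged p q I K ⟩
      disjoint p q * G (p ∨ᵥ q)
        ≈⟨ *-cong refl (sym (trans (*-cong (disjoint-emptyˡ (p ∨ᵥ q)) (reflexive (≡.cong G (∨ᵥ-identityʳ (p ∨ᵥ q)))))
                                   (*-identityˡ _))) ⟩
      disjoint p q * (disjoint (p ∨ᵥ q) emptyLabel * G ((p ∨ᵥ q) ∨ᵥ emptyLabel))
        ≈⟨ *-cong refl (sym (strip-PW-∷ Is Ks merged (p ∨ᵥ q) emptyLabel I K)) ⟩
      disjoint p q * strip ℙ 𝕎 (p ∨ᵥ q) emptyLabel (I ∷ Is) (K ∷ Ks) ∎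
      where
      merged : ∀ p' q' → strip ℙ 𝕎 p' q' Is Ks ≈ disjoint p' q' * strip ℙ 𝕎 (p' ∨ᵥ q') emptyLabel Is Ks
      merged p' q' = strip-PW-merge p' q' Is Ks
      G : Label _ → Carrier
      G D = coeffPW 0 D I K * strip ℙ 𝕎 (carryᵥ D I K) emptyLabel Is Ks

    χ∅≈poch∙χ∅ : ∀ {k} (C : Label k) → χ∅ C ≈ poch (size C) x * (χ∅ C * χ∅ (emptyLabel {k}))
    χ∅≈poch∙χ∅ {k} C with isEmpty C in empty
    ... | true = sym (begin
      poch (size C) x * (1# * χ∅ (emptyLabel {k}))
        ≡⟨ ≡.cong (λ n → poch n x * (1# * χ∅ (emptyLabel {k}))) (isEmpty⇒size≡0 C empty) ⟩
      1# * (1# * χ∅ (emptyLabel {k}))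
        ≈⟨ trans (*-identityˡ _) (trans (*-identityˡ _) (χ∅-emptyLabel k)) ⟩
      1# ∎)
    ... | false = sym (trans (*-cong refl (zeroˡ _)) (zeroʳ _))

    splitStrip≈poch∙strip-PW : ∀ {k W} (C : Label k) (Is Ks : Vec (Label k) W) →
      splitStrip C Is Ks ≈ poch (size C) x * strip ℙ 𝕎 C emptyLabel Is Ks
    splitStrip≈poch∙strip-PW C [] [] = trans (∑-split-χ∅-χ∅ C) (χ∅≈poch∙χ∅ C)
    splitStrip≈poch∙strip-PW C (I ∷ Is) (K ∷ Ks) = begin
      splitStrip C (I ∷ Is) (K ∷ Ks)                  ≈⟨ splitStrip-∷ C I K Is Ks ⟩
      coeffWP 0 C I K * splitStrip C' Is Ks           ≈⟨ *-cong refl (splitStrip≈poch∙strip-PW C' Is Ks) ⟩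
      coeffWP 0 C I K * (poch (size C') x * G C')     ≈⟨ sym (*-assoc _ _ _) ⟩
      (coeffWP 0 C I K * poch (size C') x) * G C'     ≈⟨ *-cong (sym intertwined) refl ⟩
      (poch (size C) x * coeffPW 0 C I K) * G C'      ≈⟨ *-assoc _ _ _ ⟩
      poch (size C) x * (coeffPW 0 C I K * G C')      ≈⟨ *-cong refl (sym (trans (strip-PW-∷ Is Ks merged C emptyLabel I K) unit)) ⟩
      poch (size C) x * strip ℙ 𝕎 C emptyLabel (I ∷ Is) (K ∷ Ks) ∎
      where
      C' = carryᵥ C I K
      G : Label _ → Carrier
      G D = strip ℙ 𝕎 D emptyLabel Is Ks
      merged : ∀ p' q' → strip ℙ 𝕎 p' q' Is Ks ≈ disjoint p' q' * strip ℙ 𝕎 (p' ∨ᵥ q') emptyLabel Is Ks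
      merged p' q' = strip-PW-merge p' q' Is Ks
      unit : disjoint C emptyLabel * (coeffPW 0 (C ∨ᵥ emptyLabel) I K * G (carryᵥ (C ∨ᵥ emptyLabel) I K)) ≈ coeffPW 0 C I K * G C'
      unit = trans (*-cong (disjoint-emptyˡ C) (reflexive (≡.cong (λ D → coeffPW 0 D I K * G (carryᵥ D I K)) (∨ᵥ-identityʳ C))))
                   (*-identityˡ _)
      intertwined : poch (size C) x * coeffPW 0 C I K ≈ coeffWP 0 C I K * poch (size C') x
      intertwined = trans (*-cong (poch-cong (size C) (sym (*-identityʳ x))) refl)
                          (trans (poch-intertwines 0 C I K) (*-cong refl (poch-cong (size C') (*-identityʳ x))))

    twoRows≈splitStrip-∅ : ∀ {k W} (Bs Ts : Vec (Label k) W) → twoRows 𝕎 ℙ Bs Ts ≈ splitStrip emptyLabel Bs Ts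
    twoRows≈splitStrip-∅ {k} Bs Ts = trans (∑-rowW-rowW 𝕎 ℙ emptyLabel emptyLabel Bs Ts)
                                           (sym (∑-split-emptyLabel (λ A B → strip 𝕎 ℙ A B Bs Ts)))

    white-purple-cancel : y ≈ - x → ∀ {k W} (Bs Ts : Vec (Label k) W) → twoRows 𝕎 ℙ Bs Ts ≈ χ≡ᵥ Bs Ts
    white-purple-cancel y≈-x {k} Bs Ts =
      trans (twoRows≈splitStrip-∅ Bs Ts)
            (trans (splitStrip-cancels y≈-x emptyLabel Bs Ts) (trans (*-cong (χ∅-emptyLabel k) refl) (*-identityˡ _)))

    white-purple-commute : ∀ {k W} (Bs Ts : Vec (Label k) W) → twoRows 𝕎 ℙ Bs Ts ≈ twoRows ℙ 𝕎 Bs Ts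
    white-purple-commute {k} Bs Ts = begin
      twoRows 𝕎 ℙ Bs Ts                                            ≈⟨ twoRows≈splitStrip-∅ Bs Ts ⟩
      splitStrip emptyLabel Bs Ts                                  ≈⟨ splitStrip≈poch∙strip-PW emptyLabel Bs Ts ⟩
      poch (size (emptyLabel {k})) x * strip ℙ 𝕎 emptyLabel emptyLabel Bs Ts
        ≡⟨ ≡.cong (λ n → poch n x * strip ℙ 𝕎 emptyLabel emptyLabel Bs Ts) (size-emptyLabel k) ⟩
      1# * strip ℙ 𝕎 emptyLabel emptyLabel Bs Ts                   ≈⟨ *-identityˡ _ ⟩
      strip ℙ 𝕎 emptyLabel emptyLabel Bs Ts                        ≈⟨ sym (∑-rowW-rowW ℙ 𝕎 emptyLabel emptyLabel Bs Ts) ⟩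
      twoRows ℙ 𝕎 Bs Ts                                            ∎

  Z-white-purples-cancel : ∀ {k W} (t r : Carrier) (ys : List Carrier) (Bs Ts : Vec (Label k) W) →
    Z R (white R t r List.∷ (List.map (purple R t) ys List.++ List.[ purple R t (- r) ])) Bs Ts
    ≈ Z R (List.map (purple R t) ys) Bs Ts
  Z-white-purples-cancel t r List.[] =
    Z-cancel (white R t r) (purple R t (- r)) (Train.white-purple-cancel t r (- r) refl) List.[]
  Z-white-purples-cancel {k} {W} t r (y List.∷ ys) Bs Ts =
    trans (Z-swap (white R t r) (purple R t y) (Train.white-purple-commute t r y)
                  (List.map (purple R t) ys List.++ List.[ purple R t (- r) ]) Bs Ts)
          (∑-cong (allVecs (allLabels k) W) (λ Ss → *-cong refl (Z-white-purples-cancel t r ys Ss Ts)))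

lemma4p5 : ∀ {c ℓ'} (R : CommutativeRing c ℓ') →
    let open CommutativeRing R in
    (k : ℕ) → 1 ≤ k → (ℓ N : ℕ) (lam mu : Fin k → Vec ℕ ℓ) →
    (∀ a → IsPartition (lam a)) → (∀ a → IsPartition (mu a)) →
    (∀ a i → lookup (lam a) i ≤ N) → (∀ a i → lookup (mu a) i ≤ N) →
    (n m : ℕ) (xs : Vec Carrier n) (ys : Vec Carrier m) (r t : Carrier) →
    LS R k ℓ N t lam mu (xs ∷ʳ r) (ys ∷ʳ (- r)) ≈ LS R k ℓ N t lam mu xs ys
lemma4p5 R k _ ℓ N lam mu _ _ _ _ n m xs ys r t = begin
  Z R (whites (xs ∷ʳ r) List.++ purples (ys ∷ʳ (- r))) B T
    ≡⟨ ≡.cong (λ ws → Z R ws B T) rows-rearranged ⟩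
  Z R (whites xs List.++ (white R t r List.∷ (List.map (purple R t) (Vec.toList ys) List.++ List.[ purple R t (- r) ]))) B T
    ≈⟨ RowExchange.Z-++-congˡ R (whites xs) (RowExchange.Z-white-purples-cancel R t r (Vec.toList ys)) B T ⟩
  Z R (whites xs List.++ purples ys) B T ∎
  where
  open CommutativeRing R
  open import Relation.Binary.Reasoning.Setoid setoid
  B = boundary ℓ N mu
  T = boundary ℓ N lam
  whites : ∀ {n} → Vec Carrier n → List (VertexWeight R k)
  whites xs = List.map (white R t) (Vec.toList xs)
  purples : ∀ {m} → Vec Carrier m → List (VertexWeight R k)
  purples ys = List.map (purple R t) (Vec.toList ys)
  rows-rearranged : whites (xs ∷ʳ r) List.++ purples (ys ∷ʳ (- r))
    ≡ whites xs List.++ (white R t r List.∷ (List.map (purple R t) (Vec.toList ys) List.++ List.[ purple R t (- r) ]))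
  rows-rearranged = ≡.trans
    (≡.cong₂ List._++_
      (≡.trans (≡.cong (List.map (white R t)) (VecP.toList-∷ʳ r xs)) (ListP.map-++ (white R t) (Vec.toList xs) _))
      (≡.trans (≡.cong (List.map (purple R t)) (VecP.toList-∷ʳ (- r) ys)) (ListP.map-++ (purple R t) (Vec.toList ys) _)))
    (ListP.++-assoc (whites xs) _ _)
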